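{- Let $\mathfrak{F}$ be a Frankenstein graph with partition $\{\mathsf{G}_1,\dotsc,\mathsf{G}_m\}$. Define the uncolored bipartite graph $G(\mathfrak{F})$ with parts $V_1 = \{\mathsf{G}_1,\dotsc,\mathsf{G}_m\}$ and $V_2 = $ the set of vertices $v$ such that $v$ is the unique common vertex of $\mathsf{G}_i$ and $\mathsf{G}_j$ for some $i\ne j$, where $\mathsf{G}_i \in V_1$ is adjacent to $v\in V_2$ iff $v \in V(\mathsf{G}_i)$. Then $G(\mathfrak{F})$ is acyclic (a forest).
   Context: A (colored) graph is a finite set $\mathsf{G}$ of pairs $(e,\alpha)$ where $e=\{u,v\}$ is a set of two distinct vertices and $\alpha$ is a color, such that no two pairs in $\mathsf{G}$ have the same $e$ (colors may repeat). $V(\mathsf{G})$ is the set of vertices of its edges, $\chi(\mathsf{G})$ its set of colors; a subgraph is a subset. $\mathsf{G}$ is rainbow if $|\chi(\mathsf{G})|=|\mathsf{G}|$, almost rainbow if $|\chi(\mathsf{G})|=|\mathsf{G}|-1$. Paths, cycles, trees are graphs whose underlying edges form a path, cycle, tree; a cycle is long if its length is at least $6$. A theta graph is a union of three paths with common terminals $s,t$, pairwise sharing exactly the vertices $s,t$ and no edges. A bad piece is an almost rainbow theta graph, each of whose three paths is rainbow, with at least $6$ vertices. A partition of a graph $\mathsf{G}$ is a collection $\{\mathsf{G}_1,\dots,\mathsf{G}_m\}$ of graphs with union $\mathsf{G}$ such that $|V(\mathsf{G}_i)\cap V(\mathsf{G}_j)|\le 1$ and $\chi(\mathsf{G}_i)\cap\chi(\mathsf{G}_j)=\varnothing$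 for $i\ne j$. A Frankenstein graph is a graph $\mathfrak{F}$ with a partition $\{\mathsf{C}_1,\dots,\mathsf{C}_c,\mathsf{B}_1,\dots,\mathsf{B}_b,\mathsf{T}_1,\dots,\mathsf{T}_t\}$ ($c,b,t\ge0$, $c+b+t\ge1$), where the $\mathsf{C}$'s are long rainbow cycles of odd length, the $\mathsf{B}$'s are bad pieces and the $\mathsf{T}$'s are rainbow trees, such that (F1) the trees $\mathsf{T}_p$ are pairwise vertex-disjoint, and (F2) no subgraph of $\mathfrak{F}$ is a rainbow cycle of even length. -}

module Defs where

open import Data.Nat using (ℕ; zero; suc; _≤_; _≥_; _≟_)
open import Data.Nat.Properties using ()
open import Data.Fin using (Fin)
open import Data.List using (List; []; _∷_; _++_; length; map; deduplicate)
open import Data.List.Relation.Unary.Any using (Any)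
open import Data.List.Relation.Unary.All using (All)
open import Data.List.Relation.Unary.AllPairs using (AllPairs)
import Data.List.Relation.Unary.Unique.Propositional as UniqueP
open import Data.Product using (Σ; ∃; ∃-syntax; _×_; _,_; proj₁; proj₂)
open import Data.Sum using (_⊎_; inj₁; inj₂)
open import Data.Empty using (⊥)
open import Data.Unit using (⊤)
open import Relation.Nullary using (¬_)
open import Relation.Binary.PropositionalEquality using (_≡_; _≢_)

-- A colored edge is ((u , v) , α); the pair (u , v) stands for the
-- unordered set {u , v}.  A colored graph is a list of colored edges
-- satisfying WF (endpoints distinct; no two entries with the same
-- unordered edge, in particular no repeated entries), so the list is a
-- faithful representation of a finite set of pairs (e , α).

Vertex : Set
Vertex = ℕ

Color : Set
Color = ℕ

CEdge : Set
CEdge = (Vertex × Vertex) × Color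

ColGraph : Set
ColGraph = List CEdge

edge : CEdge → Vertex × Vertex
edge = proj₁

color : CEdge → Color
color = proj₂

SameEdge : Vertex × Vertex → Vertex × Vertex → Set
SameEdge (u , v) (u' , v') = (u ≡ u' × v ≡ v') ⊎ (u ≡ v' × v ≡ u')

_∈ᶜ_ : CEdge → ColGraph → Set
e ∈ᶜ G = Any (λ f → SameEdge (edge e) (edge f) × color e ≡ color f) G

_∈ᵉ_ : Vertex × Vertex → ColGraph → Set
p ∈ᵉ G = Any (λ f → SameEdge p (edge f)) G

WF : ColGraph → Set
WF G = All (λ e → proj₁ (edge e) ≢ proj₂ (edge e)) G
     × AllPairs (λ e f → ¬ SameEdge (edge e) (edge f)) G

_⊆ᶜ_ : ColGraph → ColGraph → Set
H ⊆ᶜ G = ∀ e → e ∈ᶜ H → e ∈ᶜ G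

_∈V_ : Vertex → ColGraph → Set
x ∈V G = Any (λ e → proj₁ (edge e) ≡ x ⊎ proj₂ (edge e) ≡ x) G

vertexList : ColGraph → List Vertex
vertexList [] = []
vertexList (((u , v) , _) ∷ G) = u ∷ v ∷ vertexList G

numVertices : ColGraph → ℕ
numVertices G = length (deduplicate _≟_ (vertexList G))

_∈χ_ : Color → ColGraph → Set
α ∈χ G = Any (λ e → color e ≡ α) G

numColors : ColGraph → ℕ
numColors G = length (deduplicate _≟_ (map color G))

Rainbow : ColGraph → Set
Rainbow G = numColors G ≡ length G

AlmostRainbow : ColGraph → Set
AlmostRainbow G = suc (numColors G) ≡ length G

consec : List Vertex → List (Vertex × Vertex)
consec [] = []
consec (x ∷ []) = []
consec (x ∷ y ∷ xs) = (x , y) ∷ consec (y ∷ xs)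

EdgeSetIs : ColGraph → List (Vertex × Vertex) → Set
EdgeSetIs G ps = (∀ e → Any (λ f → f ≡ e) G → Any (SameEdge (edge e)) ps)
               × (∀ p → Any (λ q → q ≡ p) ps → p ∈ᵉ G)

IsPathBetween : Vertex → Vertex → ColGraph → Set
IsPathBetween s t G =
  Σ (List Vertex) λ mid →
    UniqueP.Unique (s ∷ mid ++ t ∷ [])
    × EdgeSetIs G (consec (s ∷ mid ++ t ∷ []))

IsPath : ColGraph → Set
IsPath G = ∃[ s ] ∃[ t ] IsPathBetween s t G

IsCycle : ColGraph → Set
IsCycle G =
  Σ Vertex λ v → Σ (List Vertex) λ rest →
    length (v ∷ rest) ≥ 3
    × UniqueP.Unique (v ∷ rest)
    × EdgeSetIs G (consec (v ∷ rest ++ v ∷ []))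

IsTree : ColGraph → Set
IsTree G =
  (G ≢ [])
  × (∀ x y → x ∈V G → y ∈V G → x ≢ y →
       Σ ColGraph λ P → WF P × P ⊆ᶜ G × IsPathBetween x y P)
  × (∀ H → WF H → H ⊆ᶜ G → ¬ IsCycle H)

IsThetaWith : Vertex → Vertex → ColGraph → ColGraph → ColGraph → ColGraph → Set
IsThetaWith s t P₁ P₂ P₃ G =
  WF P₁ × WF P₂ × WF P₃
  × IsPathBetween s t P₁ × IsPathBetween s t P₂ × IsPathBetween s t P₃
  × (∀ e → e ∈ᶜ G → e ∈ᶜ P₁ ⊎ e ∈ᶜ P₂ ⊎ e ∈ᶜ P₃)
  × (∀ e → (e ∈ᶜ P₁ ⊎ e ∈ᶜ P₂ ⊎ e ∈ᶜ P₃) → e ∈ᶜ G)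
  × ShareExactly P₁ P₂ × ShareExactly P₁ P₃ × ShareExactly P₂ P₃
  where
  ShareExactly : ColGraph → ColGraph → Set
  ShareExactly P Q =
    (∀ x → x ∈V P → x ∈V Q → x ≡ s ⊎ x ≡ t)
    × (∀ e → Any (λ f → f ≡ e) P → ¬ (edge e ∈ᵉ Q))

IsTheta : ColGraph → Set
IsTheta G = ∃[ s ] ∃[ t ] ∃[ P₁ ] ∃[ P₂ ] ∃[ P₃ ] IsThetaWith s t P₁ P₂ P₃ G

IsBadPiece : ColGraph → Set
IsBadPiece G =
  AlmostRainbow G
  × (∃[ s ] ∃[ t ] ∃[ P₁ ] ∃[ P₂ ] ∃[ P₃ ]
       (IsThetaWith s t P₁ P₂ P₃ G × Rainbow P₁ × Rainbow P₂ × Rainbow P₃))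
  × numVertices G ≥ 6

data Even : ℕ → Set where
  even-zero : Even zero
  even-ss   : ∀ {n} → Even n → Even (suc (suc n))

Odd : ℕ → Set
Odd n = ¬ Even n

IsLongOddRainbowCycle : ColGraph → Set
IsLongOddRainbowCycle G = IsCycle G × Rainbow G × length G ≥ 6 × Odd (length G)

IsPartition : ColGraph → (m : ℕ) → (Fin m → ColGraph) → Set
IsPartition F m Gs =
  (∀ i → WF (Gs i))
  × (∀ e → e ∈ᶜ F → ∃[ i ] e ∈ᶜ Gs i)
  × (∀ e i → e ∈ᶜ Gs i → e ∈ᶜ F)
  × (∀ i j → i ≢ j → ∀ x y → x ∈V Gs i → x ∈V Gs j → y ∈V Gs i → y ∈V Gs j → x ≡ y)
  × (∀ i j → i ≢ j → ∀ α → α ∈χ Gs i → α ∈χ Gs j → ⊥)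

data Kind : Set where
  cycleK badK treeK : Kind

FitsKind : Kind → ColGraph → Set
FitsKind cycleK G = IsLongOddRainbowCycle G
FitsKind badK   G = IsBadPiece G
FitsKind treeK  G = IsTree G × Rainbow G

IsFrankenstein : ColGraph → (m : ℕ) → (Fin m → ColGraph) → (Fin m → Kind) → Set
IsFrankenstein F m Gs κ =
  WF F
  × m ≥ 1
  × IsPartition F m Gs
  × (∀ i → FitsKind (κ i) (Gs i))
  -- (F1) trees pairwise vertex-disjoint
  × (∀ i j → i ≢ j → κ i ≡ treeK → κ j ≡ treeK → ∀ x → x ∈V Gs i → x ∈V Gs j → ⊥)
  -- (F2) no subgraph is a rainbow cycle of even length
  × (∀ H → WF H → H ⊆ᶜ F → IsCycle H → Rainbow H → ¬ Even (length H))

InV₂ : {m : ℕ} → (Fin m → ColGraph) → Vertex → Set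
InV₂ {m} Gs v =
  ∃[ i ] ∃[ j ] (i ≢ j × v ∈V Gs i × v ∈V Gs j
                 × (∀ w → w ∈V Gs i → w ∈V Gs j → w ≡ v))

-- adjacency of G(F), vertex set V₁ ⊎ V₂ represented as Fin m ⊎ ℕ
BipAdj : {m : ℕ} → (Fin m → ColGraph) → (Fin m ⊎ Vertex) → (Fin m ⊎ Vertex) → Set
BipAdj Gs (inj₁ i) (inj₂ v) = InV₂ Gs v × v ∈V Gs i
BipAdj Gs (inj₂ v) (inj₁ i) = InV₂ Gs v × v ∈V Gs i
BipAdj Gs (inj₁ _) (inj₁ _) = ⊥
BipAdj Gs (inj₂ _) (inj₂ _) = ⊥

Walk : {A : Set} → (A → A → Set) → List A → Set
Walk R [] = ⊤
Walk R (x ∷ []) = ⊤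
Walk R (x ∷ y ∷ xs) = R x y × Walk R (y ∷ xs)

HasCycle : {A : Set} → (A → Set) → (A → A → Set) → Set
HasCycle {A} P R =
  Σ A λ v → Σ (List A) λ rest →
    length (v ∷ rest) ≥ 3
    × UniqueP.Unique (v ∷ rest)
    × All P (v ∷ rest)
    × Walk R (v ∷ rest ++ v ∷ [])

BipVertex : {m : ℕ} → (Fin m → ColGraph) → (Fin m ⊎ Vertex) → Set
BipVertex Gs (inj₁ _) = ⊤
BipVertex Gs (inj₂ v) = InV₂ Gs v

Acyclic : {A : Set} → (A → Set) → (A → A → Set) → Set
Acyclic P R = ¬ HasCycle P R

-- A cycle of G(𝔉) through pieces 𝖦₁, …, 𝖦ₖ and shared vertices v₁, …, vₖ becomes a closed walk in 𝔉 by
-- joining v_{j-1} to v_j with a rainbow path (a leg) inside 𝖦_j. Two vertices of a long odd cycle are joined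
-- by rainbow paths of both parities (its two arcs), and so are two vertices of a bad piece: being almost
-- rainbow, it has one of its three paths sharing no colour with the other two, and this path closes two
-- rainbow cycles, odd by (F2). By (F1) two consecutive pieces are not both trees, so the walk can be made of
-- even length. Different pieces have disjoint colours, so if the legs meet only at their ends the walk is an
-- even rainbow cycle, contradicting (F2). Otherwise two legs meet at an inner vertex w, the only common vertex
-- of their pieces, and cutting both legs at w gives a shorter cyclic sequence of pieces of the same kind;
-- induction on the length concludes.

module Submission where

open import Defs
open import Data.Empty using (⊥; ⊥-elim)
open import Data.Unit using (⊤; tt)
open import Data.Product using (Σ; ∃; _×_; _,_; proj₁; proj₂)
open import Data.Sum using (_⊎_; inj₁; inj₂; [_,_]′; map₂; swap; assocʳ)
open import Data.Fin using (Fin)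
open import Data.Nat using (ℕ; zero; suc; _+_; _≤_; _<_; _≟_; z≤n; s≤s)
open import Data.Nat.Properties
  using (≤-trans; ≤-reflexive; ≤-antisym; <⇒≢; <-irrefl; suc-injective; +-comm; +-assoc; +-suc; +-monoʳ-≤)
open import Data.Nat.Induction using (<-rec)
open import Data.List using (List; []; _∷_; [_]; _++_; length; map; concat; reverse; deduplicate)
open import Data.List.Properties
  using ( length-map; length-++; length-++-comm; length-reverse; length-filter; length-deduplicate
        ; map-++; ++-assoc; ++-conicalˡ; unfold-reverse; reverse-++; ∷ʳ-injectiveˡ; filter-all; filter-notAll )
open import Data.List.Relation.Unary.Any using (Any; here; there; any?)
import Data.List.Relation.Unary.Any as Any
open import Data.List.Relation.Unary.Any.Properties using (reverse⁺; reverse⁻)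
open import Data.List.Relation.Unary.All using (All; []; _∷_)
import Data.List.Relation.Unary.All as All
import Data.List.Relation.Unary.All.Properties as AllP
open import Data.List.Relation.Unary.AllPairs using (AllPairs; []; _∷_)
import Data.List.Relation.Unary.AllPairs as AllPairs
import Data.List.Relation.Unary.AllPairs.Properties as AllPairsP
open import Data.List.Relation.Unary.Unique.Propositional using (Unique)
import Data.List.Relation.Unary.Unique.Propositional.Properties as Unique
open import Data.List.Relation.Binary.Disjoint.Propositional using (Disjoint)
import Data.List.Relation.Binary.Disjoint.Propositional.Properties as Disjoint
open import Data.List.Membership.Propositional using (_∈_; _∉_; find; lose)
open import Data.List.Membership.Propositional.Properties using (∈-++⁺ˡ; ∈-++⁺ʳ; ∈-++⁻; ∈-map⁺; ∈-map⁻; ∈-deduplicate⁺)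
open import Function using (case_of_)
open import Relation.Nullary using (¬_; Dec; yes; no; ¬?)
open import Relation.Binary.PropositionalEquality using (_≡_; _≢_; refl; sym; trans; cong; subst; subst₂)

Unique-++⁻ : ∀ {A : Set} (xs : List A) {ys} → Unique (xs ++ ys) → Unique xs × Unique ys × Disjoint xs ys
Unique-++⁻ [] u = [] , u , λ ()
Unique-++⁻ (x ∷ xs) {ys} (x∉ ∷ u) with Unique-++⁻ xs u
... | uxs , uys , disj = AllP.++⁻ˡ xs x∉ ∷ uxs , uys , disj′
  where
  disj′ : Disjoint (x ∷ xs) ys
  disj′ (here refl , v∈ys) = All.lookup x∉ (∈-++⁺ʳ xs v∈ys) refl
  disj′ (there v∈xs , v∈ys) = disj (v∈xs , v∈ys)

Unique-++-comm : ∀ {A : Set} (xs : List A) {ys} → Unique (xs ++ ys) → Unique (ys ++ xs)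
Unique-++-comm xs u with Unique-++⁻ xs u
... | uxs , uys , disj = Unique.++⁺ uys uxs λ (v∈ys , v∈xs) → disj (v∈xs , v∈ys)

Unique-map-++-comm : ∀ {A B : Set} (f : A → B) xs ys → Unique (map f (xs ++ ys)) → Unique (map f (ys ++ xs))
Unique-map-++-comm f xs ys u =
  subst Unique (sym (map-++ f ys xs)) (Unique-++-comm (map f xs) (subst Unique (map-++ f xs ys) u))

∈-map-++⁺ : ∀ {A B : Set} (f : A → B) L {R v} → v ∈ map f L ⊎ v ∈ map f R → v ∈ map f (L ++ R)
∈-map-++⁺ f L (inj₁ v∈) = subst (_ ∈_) (sym (map-++ f L _)) (∈-++⁺ˡ v∈)
∈-map-++⁺ f L (inj₂ v∈) = subst (_ ∈_) (sym (map-++ f L _)) (∈-++⁺ʳ (map f L) v∈)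

∈-++-comm : ∀ {A : Set} (xs : List A) {ys v} → v ∈ xs ++ ys → v ∈ ys ++ xs
∈-++-comm xs {ys} v∈ with ∈-++⁻ xs v∈
... | inj₁ v∈xs = ∈-++⁺ʳ ys v∈xs
... | inj₂ v∈ys = ∈-++⁺ˡ v∈ys

∈-map-++-comm : ∀ {A B : Set} (f : A → B) xs ys {v} → v ∈ map f (ys ++ xs) → v ∈ map f (xs ++ ys)
∈-map-++-comm f xs ys v∈ =
  subst (_ ∈_) (sym (map-++ f xs ys)) (∈-++-comm (map f ys) (subst (_ ∈_) (map-++ f ys xs) v∈))

Unique-map-++⇒Disjoint : ∀ {A B : Set} (f : A → B) L {R} → Unique (map f (L ++ R)) → Disjoint (map f L) (map f R)
Unique-map-++⇒Disjoint f L {R} u = proj₂ (proj₂ (Unique-++⁻ (map f L) (subst Unique (map-++ f L R) u)))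

Unique-∷ʳ : ∀ {A : Set} (xs : List A) {y} → Unique xs → y ∉ xs → Unique (xs ++ [ y ])
Unique-∷ʳ xs uxs y∉xs = Unique.++⁺ uxs ([] ∷ []) λ { (y∈xs , here refl) → y∉xs y∈xs }

Unique-reverse : ∀ {A : Set} (xs : List A) → Unique xs → Unique (reverse xs)
Unique-reverse [] u = u
Unique-reverse (x ∷ xs) (x∉ ∷ u) rewrite unfold-reverse x xs =
  Unique-∷ʳ (reverse xs) (Unique-reverse xs u) (λ x∈ → All.lookup x∉ (reverse⁻ x∈) refl)

Unique-∷⁺ : ∀ {A : Set} {x : A} {xs} → x ∉ xs → Unique xs → Unique (x ∷ xs)
Unique-∷⁺ x∉xs u = All.tabulate (λ { v∈xs refl → x∉xs v∈xs }) ∷ u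

Unique-map⇒≡ : ∀ {A B : Set} (f : A → B) {xs a b} → Unique (map f xs) → a ∈ xs → b ∈ xs → f a ≡ f b → a ≡ b
Unique-map⇒≡ f (_ ∷ _) (here refl) (here refl) _ = refl
Unique-map⇒≡ f (fa∉ ∷ _) (here refl) (there b∈) eq = ⊥-elim (All.lookup fa∉ (∈-map⁺ f b∈) eq)
Unique-map⇒≡ f (fb∉ ∷ _) (there a∈) (here refl) eq = ⊥-elim (All.lookup fb∉ (∈-map⁺ f a∈) (sym eq))
Unique-map⇒≡ f (_ ∷ u) (there a∈) (there b∈) eq = Unique-map⇒≡ f u a∈ b∈ eq

AllPairs-strengthen : ∀ {A : Set} {R S : A → A → Set} {P : A → Set} {xs} →
  (∀ {a b} → P a → P b → R a b → S a b) → All P xs → AllPairs R xs → AllPairs S xs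
AllPairs-strengthen f [] [] = []
AllPairs-strengthen f (pa ∷ ps) (ra ∷ rs) =
  All.zipWith (λ (pb , rab) → f pa pb rab) (ps , ra) ∷ AllPairs-strengthen f ps rs

dedup : List ℕ → List ℕ
dedup = deduplicate _≟_

length-dedup-∷ : ∀ x xs → length (dedup (x ∷ xs)) ≤ suc (length (dedup xs))
length-dedup-∷ x xs = s≤s (length-filter (λ y → ¬? (x ≟ y)) (dedup xs))

length-dedup-∷-∈ : ∀ {x xs} → x ∈ xs → length (dedup (x ∷ xs)) ≤ length (dedup xs)
length-dedup-∷-∈ {x} {xs} x∈xs =
  filter-notAll (λ y → ¬? (x ≟ y)) (dedup xs) (lose (∈-deduplicate⁺ _≟_ x∈xs) λ x≢x → x≢x refl)

length-dedup≡⇒Unique : ∀ xs → length (dedup xs) ≡ length xs → Unique xs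
length-dedup≡⇒Unique [] _ = []
length-dedup≡⇒Unique (x ∷ xs) eq with any? (x ≟_) xs
... | yes x∈xs = ⊥-elim (<⇒≢ (s≤s (≤-trans (length-dedup-∷-∈ x∈xs) (length-deduplicate _≟_ xs))) eq)
... | no x∉xs = Unique-∷⁺ x∉xs (length-dedup≡⇒Unique xs (≤-antisym (length-deduplicate _≟_ xs) tail≥))
  where
  tail≥ : length xs ≤ length (dedup xs)
  tail≥ = ≤-trans (≤-reflexive (suc-injective (sym eq))) (length-filter (λ y → ¬? (x ≟ y)) (dedup xs))

Unique⇒dedup≡ : ∀ {xs} → Unique xs → dedup xs ≡ xs
Unique⇒dedup≡ [] = refl
Unique⇒dedup≡ {x ∷ xs} (x∉ ∷ u) rewrite Unique⇒dedup≡ u = cong (x ∷_) (filter-all (λ y → ¬? (x ≟ y)) x∉)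

module _ {A : Set} (c : A → ℕ) where

  private
    length-dedup-map : ∀ L → length (dedup (map c L)) ≤ length L
    length-dedup-map L = subst (length (dedup (map c L)) ≤_) (length-map c L) (length-deduplicate _≟_ (map c L))

    ∈-map-≡ : ∀ {z u L} → u ∈ L → c z ≡ c u → c z ∈ map c L
    ∈-map-≡ {L = L} u∈L eq = subst (_∈ map c L) (sym eq) (∈-map⁺ c u∈L)

  collision⇒length-dedup< : ∀ {L u₁ u₂} → u₁ ∈ L → u₂ ∈ L → u₁ ≢ u₂ → c u₁ ≡ c u₂ →
    suc (length (dedup (map c L))) ≤ length L
  collision⇒length-dedup< (here refl) (here refl) u₁≢u₂ _ = ⊥-elim (u₁≢u₂ refl)
  collision⇒length-dedup< {z ∷ L} (here refl) (there u₂∈) _ eq =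
    s≤s (≤-trans (length-dedup-∷-∈ (∈-map-≡ u₂∈ eq)) (length-dedup-map L))
  collision⇒length-dedup< {z ∷ L} (there u₁∈) (here refl) _ eq =
    s≤s (≤-trans (length-dedup-∷-∈ (∈-map-≡ u₁∈ (sym eq))) (length-dedup-map L))
  collision⇒length-dedup< {z ∷ L} (there u₁∈) (there u₂∈) u₁≢u₂ eq =
    s≤s (≤-trans (length-dedup-∷ (c z) (map c L)) (collision⇒length-dedup< u₁∈ u₂∈ u₁≢u₂ eq))

  twoCollisions⇒length-dedup< : ∀ {L u₁ u₂ u₃ u₄} → u₁ ∈ L → u₂ ∈ L → u₃ ∈ L → u₄ ∈ L →
    u₁ ≢ u₂ → u₃ ≢ u₄ → u₃ ≢ u₁ → u₃ ≢ u₂ → c u₁ ≡ c u₂ → c u₃ ≡ c u₄ →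
    suc (suc (length (dedup (map c L)))) ≤ length L
  twoCollisions⇒length-dedup< _ _ (here refl) (here refl) _ n34 _ _ _ _ = ⊥-elim (n34 refl)
  twoCollisions⇒length-dedup< (here refl) _ (here refl) (there _) _ _ n31 _ _ _ = ⊥-elim (n31 refl)
  twoCollisions⇒length-dedup< (there _) (here refl) (here refl) (there _) _ _ _ n32 _ _ = ⊥-elim (n32 refl)
  twoCollisions⇒length-dedup< (here refl) (here refl) (there _) _ n12 _ _ _ _ _ = ⊥-elim (n12 refl)
  twoCollisions⇒length-dedup< {z ∷ L} (there m1) (there m2) (here refl) (there m4) n12 _ _ _ e12 e34 =
    s≤s (≤-trans (s≤s (length-dedup-∷-∈ (∈-map-≡ m4 e34))) (collision⇒length-dedup< m1 m2 n12 e12))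
  twoCollisions⇒length-dedup< {z ∷ L} (there m1) (there m2) (there m3) (here refl) n12 _ _ _ e12 e34 =
    s≤s (≤-trans (s≤s (length-dedup-∷-∈ (∈-map-≡ m3 (sym e34)))) (collision⇒length-dedup< m1 m2 n12 e12))
  twoCollisions⇒length-dedup< {z ∷ L} (here refl) (there m2) (there m3) (here refl) _ _ _ n32 e12 e34 =
    s≤s (≤-trans (s≤s (length-dedup-∷-∈ (∈-map-≡ m3 (sym e34)))) (collision⇒length-dedup< m3 m2 n32 (trans e34 e12)))
  twoCollisions⇒length-dedup< {z ∷ L} (there m1) (here refl) (there m3) (here refl) _ _ n31 _ e12 e34 =
    s≤s (≤-trans (s≤s (length-dedup-∷-∈ (∈-map-≡ m3 (sym e34)))) (collision⇒length-dedup< m3 m1 n31 (trans e34 (sym e12))))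
  twoCollisions⇒length-dedup< {z ∷ L} (here refl) (there m2) (there m3) (there m4) _ n34 _ _ e12 e34 =
    s≤s (≤-trans (s≤s (length-dedup-∷-∈ (∈-map-≡ m2 e12))) (collision⇒length-dedup< m3 m4 n34 e34))
  twoCollisions⇒length-dedup< {z ∷ L} (there m1) (here refl) (there m3) (there m4) _ n34 _ _ e12 e34 =
    s≤s (≤-trans (s≤s (length-dedup-∷-∈ (∈-map-≡ m1 (sym e12)))) (collision⇒length-dedup< m3 m4 n34 e34))
  twoCollisions⇒length-dedup< {z ∷ L} (there m1) (there m2) (there m3) (there m4) n12 n34 n31 n32 e12 e34 =
    s≤s (≤-trans (s≤s (length-dedup-∷ (c z) (map c L))) (twoCollisions⇒length-dedup< m1 m2 m3 m4 n12 n34 n31 n32 e12 e34))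

Odd⇒Even-suc : ∀ {n} → Odd n → Even (suc n)
Odd⇒Even-suc {zero} odd = ⊥-elim (odd even-zero)
Odd⇒Even-suc {suc zero} _ = even-ss even-zero
Odd⇒Even-suc {suc (suc n)} odd = even-ss (Odd⇒Even-suc (λ e → odd (even-ss e)))

Odd-suc⇒Even : ∀ {n} → Odd (suc n) → Even n
Odd-suc⇒Even {zero} _ = even-zero
Odd-suc⇒Even {suc zero} odd = ⊥-elim (odd (even-ss even-zero))
Odd-suc⇒Even {suc (suc n)} odd = even-ss (Odd-suc⇒Even (λ e → odd (even-ss e)))

Odd-+⁻ : ∀ a {b} → Odd (a + b) → (Even a × Odd b) ⊎ (Odd a × Even b)
Odd-+⁻ zero odd = inj₁ (even-zero , odd)
Odd-+⁻ (suc zero) odd = inj₂ ((λ ()) , Odd-suc⇒Even odd)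
Odd-+⁻ (suc (suc a)) odd with Odd-+⁻ a (λ e → odd (even-ss e))
... | inj₁ (ea , ob) = inj₁ (even-ss ea , ob)
... | inj₂ (oa , eb) = inj₂ ((λ { (even-ss e) → oa e }) , eb)

Odd-+⇒Even-+⊎Even-+ : ∀ n {a b} → Odd (a + b) → Even (n + a) ⊎ Even (n + b)
Odd-+⇒Even-+⊎Even-+ zero {a} odd with Odd-+⁻ a odd
... | inj₁ (ea , _) = inj₁ ea
... | inj₂ (_ , eb) = inj₂ eb
Odd-+⇒Even-+⊎Even-+ (suc zero) {a} odd with Odd-+⁻ a odd
... | inj₁ (_ , ob) = inj₂ (Odd⇒Even-suc ob)
... | inj₂ (oa , _) = inj₁ (Odd⇒Even-suc oa)
Odd-+⇒Even-+⊎Even-+ (suc (suc n)) odd with Odd-+⇒Even-+⊎Even-+ n odd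
... | inj₁ e = inj₁ (even-ss e)
... | inj₂ e = inj₂ (even-ss e)

-- Coloured edges and chains

SameEdge-refl : ∀ p → SameEdge p p
SameEdge-refl _ = inj₁ (refl , refl)

SameEdge-sym : ∀ {p q} → SameEdge p q → SameEdge q p
SameEdge-sym (inj₁ (refl , refl)) = inj₁ (refl , refl)
SameEdge-sym (inj₂ (refl , refl)) = inj₂ (refl , refl)

SameEdge-trans : ∀ {p q r} → SameEdge p q → SameEdge q r → SameEdge p r
SameEdge-trans (inj₁ (refl , refl)) s = s
SameEdge-trans (inj₂ (refl , refl)) (inj₁ (refl , refl)) = inj₂ (refl , refl)
SameEdge-trans (inj₂ (refl , refl)) (inj₂ (refl , refl)) = inj₁ (refl , refl)

SameEdge-endpoint : ∀ {p q} x → SameEdge p q → proj₁ p ≡ x ⊎ proj₂ p ≡ x → proj₁ q ≡ x ⊎ proj₂ q ≡ x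
SameEdge-endpoint x (inj₁ (refl , refl)) h = h
SameEdge-endpoint x (inj₂ (refl , refl)) (inj₁ e) = inj₂ e
SameEdge-endpoint x (inj₂ (refl , refl)) (inj₂ e) = inj₁ e

SameEdge-loopless : ∀ {p q} → SameEdge p q → proj₁ q ≢ proj₂ q → proj₁ p ≢ proj₂ p
SameEdge-loopless (inj₁ (refl , refl)) q-loopless = q-loopless
SameEdge-loopless (inj₂ (refl , refl)) q-loopless = λ e → q-loopless (sym e)

_≈ᶜ_ : CEdge → CEdge → Set
e ≈ᶜ f = SameEdge (edge e) (edge f) × color e ≡ color f

≈ᶜ-trans : ∀ {e f g} → e ≈ᶜ f → f ≈ᶜ g → e ≈ᶜ g
≈ᶜ-trans (s , c) (s′ , c′) = SameEdge-trans s s′ , trans c c′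

∈ᶜ-resp-≈ᶜ : ∀ {G e f} → e ≈ᶜ f → f ∈ᶜ G → e ∈ᶜ G
∈ᶜ-resp-≈ᶜ e≈f f∈G with find f∈G
... | g , g∈G , f≈g = lose g∈G (≈ᶜ-trans e≈f f≈g)

∈⇒∈ᶜ : ∀ {G e} → e ∈ G → e ∈ᶜ G
∈⇒∈ᶜ {e = e} e∈G = lose e∈G (SameEdge-refl (edge e) , refl)

∈ᶜ-loopless : ∀ {G e} → WF G → e ∈ᶜ G → proj₁ (edge e) ≢ proj₂ (edge e)
∈ᶜ-loopless (loopless , _) e∈G with find e∈G
... | g , g∈G , (s , _) = SameEdge-loopless s (All.lookup loopless g∈G)

WF-SameEdge⇒≡ : ∀ {G a b} → WF G → a ∈ G → b ∈ G → SameEdge (edge a) (edge b) → a ≡ b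
WF-SameEdge⇒≡ _ (here refl) (here refl) _ = refl
WF-SameEdge⇒≡ (_ , (distinct ∷ _)) (here refl) (there b∈) s = ⊥-elim (All.lookup distinct b∈ s)
WF-SameEdge⇒≡ (_ , (distinct ∷ _)) (there a∈) (here refl) s = ⊥-elim (All.lookup distinct a∈ (SameEdge-sym s))
WF-SameEdge⇒≡ (_ ∷ loopless , _ ∷ distinct) (there a∈) (there b∈) s = WF-SameEdge⇒≡ (loopless , distinct) a∈ b∈ s

WF-SameEdge⇒sameColor : ∀ {G e f} → WF G → e ∈ᶜ G → f ∈ᶜ G → SameEdge (edge e) (edge f) → color e ≡ color f
WF-SameEdge⇒sameColor wf e∈G f∈G s with find e∈G | find f∈G
... | g , g∈G , (s₁ , c₁) | g′ , g′∈G , (s₂ , c₂)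
  with refl ← WF-SameEdge⇒≡ wf g∈G g′∈G (SameEdge-trans (SameEdge-sym s₁) (SameEdge-trans s s₂)) = trans c₁ (sym c₂)

∈ᶜ⇒∈χ : ∀ {G e} → e ∈ᶜ G → color e ∈χ G
∈ᶜ⇒∈χ e∈G with find e∈G
... | g , g∈G , (_ , c) = lose g∈G (sym c)

src tgt : CEdge → Vertex
src e = proj₁ (edge e)
tgt e = proj₂ (edge e)

∈ᶜ⇒∈V : ∀ {G e z} → e ∈ᶜ G → src e ≡ z ⊎ tgt e ≡ z → z ∈V G
∈ᶜ⇒∈V {z = z} e∈G z∈e with find e∈G
... | g , g∈G , (s , _) = lose g∈G (SameEdge-endpoint z s z∈e)

-- Paths and cycles are handled as chains of oriented copies of edges; they lie in G only up to SameEdge (∈ᶜ).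
Chain : Vertex → Vertex → List CEdge → Set
Chain x y [] = x ≡ y
Chain x y (e ∷ es) = src e ≡ x × Chain (tgt e) y es

sources : List CEdge → List Vertex
sources = map src

vertices : Vertex → List CEdge → List Vertex
vertices x es = x ∷ map tgt es

colors : List CEdge → List Color
colors = map color

sources-∷ʳ : ∀ {x y} es → Chain x y es → sources es ++ [ y ] ≡ vertices x es
sources-∷ʳ [] refl = refl
sources-∷ʳ (e ∷ es) (refl , c) = cong (src e ∷_) (sources-∷ʳ es c)

consec-vertices : ∀ {x y} es → Chain x y es → consec (vertices x es) ≡ map edge es
consec-vertices [] refl = refl
consec-vertices (e ∷ es) (refl , c) = cong (edge e ∷_) (consec-vertices es c)

sources⊆vertices : ∀ {x y v} es → Chain x y es → v ∈ sources es → v ∈ vertices x es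
sources⊆vertices es c v∈ = subst (_ ∈_) (sources-∷ʳ es c) (∈-++⁺ˡ v∈)

end∈vertices : ∀ {x y} es → Chain x y es → y ∈ vertices x es
end∈vertices es c = subst (_ ∈_) (sources-∷ʳ es c) (∈-++⁺ʳ (sources es) (here refl))

vertices⊆sources∷ʳ : ∀ {x y v} es → Chain x y es → v ∈ vertices x es → v ∈ sources es ⊎ v ≡ y
vertices⊆sources∷ʳ es c v∈ with ∈-++⁻ (sources es) (subst (_ ∈_) (sym (sources-∷ʳ es c)) v∈)
... | inj₁ v∈sources = inj₁ v∈sources
... | inj₂ (here refl) = inj₂ refl

start∈sources : ∀ {x y} es → Chain x y es → x ≢ y → x ∈ sources es
start∈sources [] refl x≢y = ⊥-elim (x≢y refl)
start∈sources (e ∷ es) (refl , _) _ = here refl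

Chain⇒≢[] : ∀ {x y} es → Chain x y es → x ≢ y → es ≢ []
Chain⇒≢[] [] refl x≢y _ = x≢y refl
Chain⇒≢[] (_ ∷ _) _ _ ()

chain-++ : ∀ {x y z} as {bs} → Chain x y as → Chain y z bs → Chain x z (as ++ bs)
chain-++ [] refl c = c
chain-++ (e ∷ as) (p , c) c′ = p , chain-++ as c c′

vertices-++ : ∀ {x z} as bs → Chain x z as → vertices x (as ++ bs) ≡ sources as ++ vertices z bs
vertices-++ [] bs refl = refl
vertices-++ (e ∷ as) bs (refl , c) = cong (src e ∷_) (vertices-++ as bs c)

chain-split : ∀ {x y z} es → Chain x y es → z ∈ sources es →
  Σ (List CEdge) λ as → Σ (List CEdge) λ bs → es ≡ as ++ bs × Chain x z as × Chain z y bs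
chain-split (e ∷ es) (p , c) (here refl) = [] , e ∷ es , refl , sym p , (refl , c)
chain-split (e ∷ es) (p , c) (there z∈) with chain-split es c z∈
... | as , bs , refl , c₁ , c₂ = e ∷ as , bs , refl , (p , c₁) , c₂

flip : CEdge → CEdge
flip e = ((tgt e , src e) , color e)

reverseChain : List CEdge → List CEdge
reverseChain es = reverse (map flip es)

private
  reverseChain-∷ : ∀ e es → reverseChain (e ∷ es) ≡ reverseChain es ++ [ flip e ]
  reverseChain-∷ e es = unfold-reverse (flip e) (map flip es)

  map-reverseChain : ∀ {A : Set} (f g : CEdge → A) → (∀ e → f (flip e) ≡ g e) →
    ∀ es → map f (reverseChain es) ≡ reverse (map g es)
  map-reverseChain f g fg [] = refl
  map-reverseChain f g fg (e ∷ es)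
    rewrite reverseChain-∷ e es | map-++ f (reverseChain es) [ flip e ] | map-reverseChain f g fg es | fg e =
    sym (unfold-reverse (g e) (map g es))

chain-reverse : ∀ {x y} es → Chain x y es → Chain y x (reverseChain es)
chain-reverse [] refl = refl
chain-reverse (e ∷ es) (p , c) rewrite reverseChain-∷ e es = chain-++ (reverseChain es) (chain-reverse es c) (refl , p)

colors-reverseChain : ∀ es → colors (reverseChain es) ≡ reverse (colors es)
colors-reverseChain = map-reverseChain color color λ _ → refl

length-reverseChain : ∀ es → length (reverseChain es) ≡ length es
length-reverseChain es = trans (length-reverse (map flip es)) (length-map flip es)

vertices-reverseChain : ∀ {x y} es → Chain x y es → vertices y (reverseChain es) ≡ reverse (vertices x es)
vertices-reverseChain {x} {y} es c =
  trans (cong (y ∷_) (map-reverseChain tgt src (λ _ → refl) es))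
        (trans (sym (reverse-++ (sources es) [ y ])) (cong reverse (sources-∷ʳ es c)))

∈-vertices-reverseChain : ∀ {x y v} es → Chain x y es → v ∈ vertices y (reverseChain es) → v ∈ vertices x es
∈-vertices-reverseChain es c v∈ = reverse⁻ (subst (_ ∈_) (vertices-reverseChain es c) v∈)

∈-colors-reverseChain : ∀ {α} es → α ∈ colors (reverseChain es) → α ∈ colors es
∈-colors-reverseChain es α∈ = reverse⁻ (subst (_ ∈_) (colors-reverseChain es) α∈)

All∈ᶜ-reverseChain : ∀ {G} es → All (_∈ᶜ G) es → All (_∈ᶜ G) (reverseChain es)
All∈ᶜ-reverseChain {G} es es⊆G = All.tabulate λ e∈ → flipped (reverse⁻ e∈)
  where
  flipped : ∀ {e} → e ∈ map flip es → e ∈ᶜ G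
  flipped e∈ with ∈-map⁻ flip e∈
  ... | f , f∈ , refl = ∈ᶜ-resp-≈ᶜ (inj₂ (refl , refl) , refl) (All.lookup es⊆G f∈)

RainbowPath : ColGraph → Vertex → Vertex → List CEdge → Set
RainbowPath G x y es = Chain x y es × All (_∈ᶜ G) es × Unique (vertices x es) × Unique (colors es)

RainbowPath-reverse : ∀ {G x y} es → RainbowPath G x y es → RainbowPath G y x (reverseChain es)
RainbowPath-reverse es (c , es⊆G , uv , uc) =
  chain-reverse es c , All∈ᶜ-reverseChain es es⊆G ,
  subst Unique (sym (vertices-reverseChain es c)) (Unique-reverse _ uv) ,
  subst Unique (sym (colors-reverseChain es)) (Unique-reverse _ uc)

RainbowPath-mono : ∀ {P G x y es} → P ⊆ᶜ G → RainbowPath P x y es → RainbowPath G x y es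
RainbowPath-mono P⊆G (c , es⊆P , uv , uc) = c , All.map (λ {e} → P⊆G e) es⊆P , uv , uc

Unique-sources : ∀ {G x y} es → RainbowPath G x y es → Unique (sources es)
Unique-sources es (c , _ , uv , _) = proj₁ (Unique-++⁻ (sources es) (subst Unique (sym (sources-∷ʳ es c)) uv))

end∉sources : ∀ {G x y} es → RainbowPath G x y es → y ∉ sources es
end∉sources es (c , _ , uv , _) y∈ =
  proj₂ (proj₂ (Unique-++⁻ (sources es) (subst Unique (sym (sources-∷ʳ es c)) uv))) (y∈ , here refl)

RainbowPath-++ : ∀ {G x z y} as bs → RainbowPath G x z as → RainbowPath G z y bs →
  Disjoint (sources as) (vertices z bs) → Disjoint (colors as) (colors bs) → RainbowPath G x y (as ++ bs)
RainbowPath-++ as bs pa@(ca , as⊆G , _ , uca) (cb , bs⊆G , uvb , ucb) dv dc =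
  chain-++ as ca cb , AllP.++⁺ as⊆G bs⊆G ,
  subst Unique (sym (vertices-++ as bs ca)) (Unique.++⁺ (Unique-sources as pa) uvb dv) ,
  subst Unique (sym (map-++ color as bs)) (Unique.++⁺ uca ucb dc)

RainbowPath-split : ∀ {G x y z} es → RainbowPath G x y es → z ∈ sources es →
  Σ (List CEdge) λ L → Σ (List CEdge) λ R → es ≡ L ++ R × RainbowPath G x z L × RainbowPath G z y R
RainbowPath-split es (c , es⊆G , uv , uc) z∈ with chain-split es c z∈
... | L , R , refl , cL , cR
  with Unique-++⁻ (sources L) (subst Unique (vertices-++ L R cL) uv) | Unique-++⁻ (colors L) (subst Unique (map-++ color L R) uc)
... | usL , uvR , disjoint | ucL , ucR , _ =
  L , R , refl ,
  (cL , AllP.++⁻ˡ L es⊆G , subst Unique (sources-∷ʳ L cL) (Unique-∷ʳ (sources L) usL (λ z∈L → disjoint (z∈L , here refl))) , ucL) ,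
  (cR , AllP.++⁻ʳ L es⊆G , uvR , ucR)

vertices⊆V : ∀ {G x y} es → RainbowPath G x y es → x ≢ y → ∀ {v} → v ∈ vertices x es → v ∈V G
vertices⊆V [] (refl , _) x≢y _ = ⊥-elim (x≢y refl)
vertices⊆V (e ∷ es) ((refl , _) , e∈G ∷ _ , _) _ (here refl) = ∈ᶜ⇒∈V e∈G (inj₁ refl)
vertices⊆V (e ∷ es) (_ , es⊆G , _) _ (there v∈) with ∈-map⁻ tgt v∈
... | f , f∈ , refl = ∈ᶜ⇒∈V (All.lookup es⊆G f∈) (inj₂ refl)

colors⊆χ : ∀ {G} es → All (_∈ᶜ G) es → ∀ {α} → α ∈ colors es → α ∈χ G
colors⊆χ es es⊆G α∈ with ∈-map⁻ color α∈
... | f , f∈ , refl = ∈ᶜ⇒∈χ (All.lookup es⊆G f∈)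

∈-consec : ∀ xs {p} → p ∈ consec xs → proj₁ p ∈ xs × proj₂ p ∈ xs
∈-consec (a ∷ b ∷ xs) (here refl) = here refl , there (here refl)
∈-consec (a ∷ b ∷ xs) (there p∈) with ∈-consec (b ∷ xs) p∈
... | a∈ , b∈ = there a∈ , there b∈

proj₁-∈-consec-∷ʳ : ∀ xs {y p} → p ∈ consec (xs ++ [ y ]) → proj₁ p ∈ xs
proj₁-∈-consec-∷ʳ (a ∷ []) (here refl) = here refl
proj₁-∈-consec-∷ʳ (a ∷ b ∷ xs) (here refl) = here refl
proj₁-∈-consec-∷ʳ (a ∷ b ∷ xs) (there p∈) = there (proj₁-∈-consec-∷ʳ (b ∷ xs) p∈)

consec-covers : ∀ xs {z} → z ∈ xs → 2 ≤ length xs → ∃ λ p → p ∈ consec xs × (proj₁ p ≡ z ⊎ proj₂ p ≡ z)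
consec-covers (a ∷ []) (here refl) (s≤s ())
consec-covers (a ∷ b ∷ xs) (here refl) _ = (a , b) , here refl , inj₁ refl
consec-covers (a ∷ b ∷ xs) (there (here refl)) _ = (a , b) , here refl , inj₂ refl
consec-covers (a ∷ b ∷ c ∷ xs) (there (there z∈)) _ with consec-covers (b ∷ c ∷ xs) (there z∈) (s≤s (s≤s z≤n))
... | p , p∈ , z∈p = p , there p∈ , z∈p

DistinctEdges : List (Vertex × Vertex) → Set
DistinctEdges = AllPairs (λ p q → ¬ SameEdge p q)

Unique⇒DistinctEdges-consec : ∀ xs → Unique xs → DistinctEdges (consec xs)
Unique⇒DistinctEdges-consec [] _ = []
Unique⇒DistinctEdges-consec (a ∷ []) _ = []
Unique⇒DistinctEdges-consec (a ∷ b ∷ xs) (a∉ ∷ u) =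
  All.tabulate (λ q∈ → fresh (∈-consec (b ∷ xs) q∈)) ∷ Unique⇒DistinctEdges-consec (b ∷ xs) u
  where
  fresh : ∀ {q} → proj₁ q ∈ b ∷ xs × proj₂ q ∈ b ∷ xs → ¬ SameEdge (a , b) q
  fresh (c∈ , _) (inj₁ (refl , _)) = All.lookup a∉ c∈ refl
  fresh (_ , d∈) (inj₂ (refl , _)) = All.lookup a∉ d∈ refl

Unique⇒DistinctEdges-cycle : ∀ v rest → Unique (v ∷ rest) → 3 ≤ length (v ∷ rest) →
  DistinctEdges (consec (v ∷ rest ++ [ v ]))
Unique⇒DistinctEdges-cycle v [] _ (s≤s ())
Unique⇒DistinctEdges-cycle v (_ ∷ []) _ (s≤s (s≤s ()))
Unique⇒DistinctEdges-cycle v (r₁ ∷ r₂ ∷ rest) (v∉ ∷ u@(r₁∉ ∷ _)) _ =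
  All.tabulate closing ∷ Unique⇒DistinctEdges-consec (r₁ ∷ r₂ ∷ rest ++ [ v ]) (Unique-∷ʳ (r₁ ∷ r₂ ∷ rest) u v∉′)
  where
  v∉′ : v ∉ r₁ ∷ r₂ ∷ rest
  v∉′ v∈ = All.lookup v∉ v∈ refl
  closing : ∀ {q} → q ∈ consec (r₁ ∷ r₂ ∷ rest ++ [ v ]) → ¬ SameEdge (v , r₁) q
  closing q∈ (inj₁ (refl , _)) = v∉′ (proj₁-∈-consec-∷ʳ (r₁ ∷ r₂ ∷ rest) q∈)
  closing (here refl) (inj₂ (refl , _)) = v∉′ (there (here refl))
  closing (there q∈) (inj₂ (_ , refl)) = All.lookup r₁∉ (proj₁-∈-consec-∷ʳ (r₂ ∷ rest) q∈) refl

EdgeBetween : ColGraph → Vertex → Vertex → Set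
EdgeBetween G a b = Σ CEdge λ g → g ∈ G × SameEdge (a , b) (edge g)

edgesAlong : ∀ {G} vs → Walk (EdgeBetween G) vs → List CEdge
edgesAlong [] _ = []
edgesAlong (x ∷ []) _ = []
edgesAlong (x ∷ y ∷ vs) ((g , _) , w) = ((x , y) , color g) ∷ edgesAlong (y ∷ vs) w

last : Vertex → List Vertex → Vertex
last x [] = x
last x (y ∷ ys) = last y ys

last-∷ʳ : ∀ x ws y → last x (ws ++ [ y ]) ≡ y
last-∷ʳ x [] y = refl
last-∷ʳ x (w ∷ ws) y = last-∷ʳ w ws y

module _ {G : ColGraph} where

  chain-edgesAlong : ∀ x ws (w : Walk (EdgeBetween G) (x ∷ ws)) → Chain x (last x ws) (edgesAlong (x ∷ ws) w)
  chain-edgesAlong x [] w = refl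
  chain-edgesAlong x (y ∷ ws) (_ , w) = refl , chain-edgesAlong y ws w

  vertices-edgesAlong : ∀ x ws (w : Walk (EdgeBetween G) (x ∷ ws)) → vertices x (edgesAlong (x ∷ ws) w) ≡ x ∷ ws
  vertices-edgesAlong x [] w = refl
  vertices-edgesAlong x (y ∷ ws) (_ , w) = cong (x ∷_) (vertices-edgesAlong y ws w)

  edge-edgesAlong : ∀ vs (w : Walk (EdgeBetween G) vs) → map edge (edgesAlong vs w) ≡ consec vs
  edge-edgesAlong [] w = refl
  edge-edgesAlong (x ∷ []) w = refl
  edge-edgesAlong (x ∷ y ∷ vs) (_ , w) = cong ((x , y) ∷_) (edge-edgesAlong (y ∷ vs) w)

  edgesAlong⊆ : ∀ vs (w : Walk (EdgeBetween G) vs) → All (_∈ᶜ G) (edgesAlong vs w)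
  edgesAlong⊆ [] w = []
  edgesAlong⊆ (x ∷ []) w = []
  edgesAlong⊆ (x ∷ y ∷ vs) ((g , g∈ , s) , w) = lose g∈ (s , refl) ∷ edgesAlong⊆ (y ∷ vs) w

  Unique-colors-edgesAlong : ∀ vs (w : Walk (EdgeBetween G) vs) → Unique (colors G) → DistinctEdges (consec vs) →
    Unique (colors (edgesAlong vs w))
  Unique-colors-edgesAlong vs w ucG distinct =
    Unique-colors-⊆ (edgesAlong vs w) (edgesAlong⊆ vs w)
      (AllPairsP.map⁻ (subst DistinctEdges (sym (edge-edgesAlong vs w)) distinct))
    where
    Unique-colors-⊆ : ∀ es → All (_∈ᶜ G) es → AllPairs (λ e f → ¬ SameEdge (edge e) (edge f)) es → Unique (colors es)
    Unique-colors-⊆ [] _ _ = []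
    Unique-colors-⊆ (e ∷ es) (e∈G ∷ es⊆G) (e-fresh ∷ ds) =
      AllP.map⁺ (All.tabulate different) ∷ Unique-colors-⊆ es es⊆G ds
      where
      different : ∀ {f} → f ∈ es → color e ≢ color f
      different f∈ eq with find e∈G | find (All.lookup es⊆G f∈)
      ... | g , g∈ , (s₁ , c₁) | g′ , g′∈ , (s₂ , c₂)
        with refl ← Unique-map⇒≡ color ucG g∈ g′∈ (trans (sym c₁) (trans eq c₂)) =
        All.lookup e-fresh f∈ (SameEdge-trans s₁ (SameEdge-sym s₂))

walk-EdgeSetIs : ∀ {G} vs → EdgeSetIs G (consec vs) → Walk (EdgeBetween G) vs
walk-EdgeSetIs vs (_ , edges⊆G) = walk vs (λ p∈ → edges⊆G _ (Any.map sym p∈))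
  where
  walk : ∀ {G} vs → (∀ {p} → p ∈ consec vs → p ∈ᵉ G) → Walk (EdgeBetween G) vs
  walk [] _ = tt
  walk (x ∷ []) _ = tt
  walk (x ∷ y ∷ vs) h = find (h (here refl)) , walk (y ∷ vs) (λ p∈ → h (there p∈))

V⊆-EdgeSetIs : ∀ {G} vs → EdgeSetIs G (consec vs) → ∀ {x} → x ∈V G → x ∈ vs
V⊆-EdgeSetIs vs (G⊆edges , _) {x} x∈G with find x∈G
... | e , e∈ , x∈e with find (G⊆edges e (Any.map sym e∈))
... | p , p∈ , s with SameEdge-endpoint x s x∈e | ∈-consec vs p∈
... | inj₁ refl | a∈ , _ = a∈
... | inj₂ refl | _ , b∈ = b∈

⊆V-EdgeSetIs : ∀ {G} vs → EdgeSetIs G (consec vs) → 2 ≤ length vs → ∀ {x} → x ∈ vs → x ∈V G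
⊆V-EdgeSetIs vs (_ , edges⊆G) len {x} x∈ with consec-covers vs x∈ len
... | p , p∈ , x∈p with find (edges⊆G p (Any.map sym p∈))
... | f , f∈ , s = lose f∈ (SameEdge-endpoint x s x∈p)

Rainbow⇒Unique-colors : ∀ {G} → Rainbow G → Unique (colors G)
Rainbow⇒Unique-colors {G} rb = length-dedup≡⇒Unique (colors G) (trans rb (sym (length-map color G)))

-- Rainbow circuits

-- For length ≥ 3 this is a rainbow cycle in the sense of IsCycle.
RainbowCircuit : ColGraph → Vertex → List CEdge → Set
RainbowCircuit G x es = Chain x x es × All (_∈ᶜ G) es × Unique (sources es) × Unique (colors es)

RainbowCircuit-mono : ∀ {G H x es} → G ⊆ᶜ H → RainbowCircuit G x es → RainbowCircuit H x es
RainbowCircuit-mono G⊆H (c , es⊆G , us , uc) = c , All.map (λ {e} → G⊆H e) es⊆G , us , uc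

NoEvenRainbowCycle : ColGraph → Set
NoEvenRainbowCycle F = ∀ H → WF H → H ⊆ᶜ F → IsCycle H → Rainbow H → ¬ Even (length H)

module _ {F : ColGraph} (wfF : WF F) (noEven : NoEvenRainbowCycle F) where

  -- Circuits of length 1 and 2 are excluded by well-formedness; longer ones are cycles of F.
  RainbowCircuit-odd : ∀ {x} es → RainbowCircuit F x es → es ≢ [] → Odd (length es)
  RainbowCircuit-odd [] _ es≢[] _ = es≢[] refl
  RainbowCircuit-odd (e ∷ []) ((p , refl) , e∈F ∷ [] , _) _ _ = ∈ᶜ-loopless wfF e∈F p
  RainbowCircuit-odd (e₁ ∷ e₂ ∷ []) ((p₁ , p₂ , refl) , e₁∈F ∷ e₂∈F ∷ [] , _ , (c₁≢c₂ ∷ []) ∷ _) _ _ =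
    c₁≢c₂ (WF-SameEdge⇒sameColor wfF e₁∈F e₂∈F (inj₂ (p₁ , sym p₂)))
  RainbowCircuit-odd {x} H@(e ∷ e₂ ∷ e₃ ∷ es) (c , H⊆F , us , uc) _ = noEven H wfH H⊆ᶜF isCycle rainbow
    where
    wfH : WF H
    wfH = All.map (∈ᶜ-loopless wfF) H⊆F ,
          AllPairs-strengthen (λ e∈F f∈F c≢ s → c≢ (WF-SameEdge⇒sameColor wfF e∈F f∈F s)) H⊆F (AllPairsP.map⁻ uc)
    H⊆ᶜF : H ⊆ᶜ F
    H⊆ᶜF f f∈H with find f∈H
    ... | h , h∈H , f≈h = ∈ᶜ-resp-≈ᶜ f≈h (All.lookup H⊆F h∈H)
    edgeSet : EdgeSetIs H (map edge H)
    edgeSet = (λ f f∈H → lose (∈-map⁺ edge (Any.map sym f∈H)) (SameEdge-refl (edge f))) ,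
              (λ p p∈ → onEdge (Any.map sym p∈))
      where
      onEdge : ∀ {p} → p ∈ map edge H → p ∈ᵉ H
      onEdge p∈ with ∈-map⁻ edge p∈
      ... | f , f∈H , refl = lose f∈H (SameEdge-refl (edge f))
    isCycle : IsCycle H
    isCycle = src e , sources (e₂ ∷ e₃ ∷ es) , s≤s (s≤s (s≤s z≤n)) , us ,
      subst (λ z → EdgeSetIs H (consec (sources H ++ [ z ]))) (sym (proj₁ c))
        (subst (λ vs → EdgeSetIs H (consec vs)) (sym (sources-∷ʳ H c))
          (subst (EdgeSetIs H) (sym (consec-vertices H c)) edgeSet))
    rainbow : Rainbow H
    rainbow = trans (cong length (Unique⇒dedup≡ uc)) (length-map color H)

RainbowCircuit-rotate : ∀ {G x z} es → RainbowCircuit G x es → z ∈ sources es →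
  Σ (List CEdge) λ es′ → RainbowCircuit G z es′ × length es′ ≡ length es
    × (∀ {v} → v ∈ sources es → v ∈ sources es′) × (∀ {v} → v ∈ sources es′ → v ∈ sources es)
    × (∀ {α} → α ∈ colors es′ → α ∈ colors es)
RainbowCircuit-rotate es (c , es⊆G , us , uc) z∈ with chain-split es c z∈
... | as , bs , refl , ca , cb =
  bs ++ as ,
  (chain-++ bs cb ca , AllP.++⁺ (AllP.++⁻ʳ as es⊆G) (AllP.++⁻ˡ as es⊆G) ,
   Unique-map-++-comm src as bs us , Unique-map-++-comm color as bs uc) ,
  length-++-comm bs as ,
  ∈-map-++-comm src bs as , ∈-map-++-comm src as bs , ∈-map-++-comm color as bs

RainbowCircuit-split : ∀ {G x y} es → RainbowCircuit G x es → y ∈ sources es → x ≢ y →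
  Σ (List CEdge) λ P → Σ (List CEdge) λ Q → es ≡ P ++ Q × RainbowPath G x y P × RainbowPath G y x Q
RainbowCircuit-split {x = x} {y} es (c , es⊆G , us , uc) y∈ x≢y with chain-split es c y∈
... | P , Q , refl , cP , cQ
  with Unique-++⁻ (sources P) (subst Unique (map-++ src P Q) us) | Unique-++⁻ (colors P) (subst Unique (map-++ color P Q) uc)
... | usP , usQ , disjoint | ucP , ucQ , _ =
  P , Q , refl ,
  (cP , AllP.++⁻ˡ P es⊆G , subst Unique (sources-∷ʳ P cP) (Unique-∷ʳ (sources P) usP (λ y∈P → disjoint (y∈P , y∈Q))) , ucP) ,
  (cQ , AllP.++⁻ʳ P es⊆G , subst Unique (sources-∷ʳ Q cQ) (Unique-∷ʳ (sources Q) usQ (λ x∈Q → disjoint (x∈P , x∈Q))) , ucQ)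
  where
  x∈P : x ∈ sources P
  x∈P = start∈sources P cP x≢y
  y∈Q : y ∈ sources Q
  y∈Q = start∈sources Q cQ (λ e → x≢y (sym e))

-- Even (n + length p): the length of p has the parity of n.
PathWithin : ColGraph → List CEdge → ℕ → Vertex → Vertex → Set
PathWithin G C n x y = Σ (List CEdge) λ p → RainbowPath G x y p × Even (n + length p)
  × (∀ {v} → v ∈ vertices x p → v ∈ sources C) × (∀ {α} → α ∈ colors p → α ∈ colors C)

-- The two arcs of an odd circuit between x and y have lengths of different parities.
oddCircuit⇒PathWithin : ∀ {G x₀} C → RainbowCircuit G x₀ C → Odd (length C) →
  ∀ {x y} → x ∈ sources C → y ∈ sources C → x ≢ y → ∀ n → PathWithin G C n x y
oddCircuit⇒PathWithin C circ odd {x} {y} x∈ y∈ x≢y n with RainbowCircuit-rotate C circ x∈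
... | C′ , circ′ , len≡ , toC′ , fromC′ , colorsFromC′ with RainbowCircuit-split C′ circ′ (toC′ y∈) x≢y
... | P , Q , refl , pathP , pathQ with Odd-+⇒Even-+⊎Even-+ n {length P} {length Q} oddPQ
  where
  oddPQ : Odd (length P + length Q)
  oddPQ e = odd (subst Even (trans (sym (length-++ P)) len≡) e)
... | inj₁ even = P , pathP , even , verticesP , λ α∈ → colorsFromC′ (∈-map-++⁺ color P (inj₁ α∈))
  where
  verticesP : ∀ {v} → v ∈ vertices x P → v ∈ sources C
  verticesP v∈ with vertices⊆sources∷ʳ P (proj₁ pathP) v∈
  ... | inj₁ v∈P = fromC′ (∈-map-++⁺ src P (inj₁ v∈P))
  ... | inj₂ refl = y∈
... | inj₂ even =
  reverseChain Q , RainbowPath-reverse Q pathQ , subst (λ k → Even (n + k)) (sym (length-reverseChain Q)) even ,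
  verticesQ , λ α∈ → colorsFromC′ (∈-map-++⁺ color P (inj₂ (∈-colors-reverseChain Q α∈)))
  where
  verticesQ : ∀ {v} → v ∈ vertices x (reverseChain Q) → v ∈ sources C
  verticesQ v∈ with vertices⊆sources∷ʳ Q (proj₁ pathQ) (∈-vertices-reverseChain Q (proj₁ pathQ) v∈)
  ... | inj₁ v∈Q = fromC′ (∈-map-++⁺ src P (inj₂ v∈Q))
  ... | inj₂ refl = x∈

-- Rainbow paths inside the pieces

BothParities : ColGraph → Vertex → Vertex → Set
BothParities G x y = ∀ n → Σ (List CEdge) λ es → RainbowPath G x y es × Even (n + length es)

liftEdge : ∀ {P G a b} → P ⊆ᶜ G → EdgeBetween P a b → EdgeBetween G a b
liftEdge P⊆G (f , f∈P , s) with find (P⊆G f (∈⇒∈ᶜ f∈P))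
... | g , g∈G , (s′ , _) = g , g∈G , SameEdge-trans s s′

liftWalk : ∀ {P G} → P ⊆ᶜ G → ∀ vs → Walk (EdgeBetween P) vs → Walk (EdgeBetween G) vs
liftWalk P⊆G [] _ = tt
liftWalk P⊆G (x ∷ []) _ = tt
liftWalk P⊆G (x ∷ y ∷ vs) (e , w) = liftEdge P⊆G e , liftWalk P⊆G (y ∷ vs) w

IsPathBetween⇒RainbowPath : ∀ {P G s t} → Unique (colors G) → P ⊆ᶜ G → ((mid , _) : IsPathBetween s t P) →
  Σ (List CEdge) λ es → RainbowPath G s t es × vertices s es ≡ s ∷ mid ++ [ t ]
IsPathBetween⇒RainbowPath {G = G} {s} {t} ucG P⊆G (mid , u , edgeSet) =
  es , (chain , edgesAlong⊆ vs w , subst Unique (sym vertices≡) u ,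
        Unique-colors-edgesAlong vs w ucG (Unique⇒DistinctEdges-consec vs u)) , vertices≡
  where
  vs : List Vertex
  vs = s ∷ mid ++ [ t ]
  w : Walk (EdgeBetween G) vs
  w = liftWalk P⊆G vs (walk-EdgeSetIs vs edgeSet)
  es : List CEdge
  es = edgesAlong vs w
  vertices≡ : vertices s es ≡ vs
  vertices≡ = vertices-edgesAlong s (mid ++ [ t ]) w
  chain : Chain s t es
  chain = subst (λ z → Chain s z es) (last-∷ʳ s mid t) (chain-edgesAlong s (mid ++ [ t ]) w)

tree⇒RainbowPath : ∀ {G x y} → IsTree G → Rainbow G → x ∈V G → y ∈V G → x ≢ y → ∃ (RainbowPath G x y)
tree⇒RainbowPath {x = x} {y} (_ , connected , _) rainbow x∈ y∈ x≢y with connected x y x∈ y∈ x≢y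
... | P , _ , P⊆G , path with IsPathBetween⇒RainbowPath (Rainbow⇒Unique-colors rainbow) P⊆G path
... | es , rp , _ = es , rp

module _ {F : ColGraph} (wfF : WF F) (noEven : NoEvenRainbowCycle F) where

  oddCycle⇒BothParities : ∀ {G x y} → G ⊆ᶜ F → IsLongOddRainbowCycle G → x ∈V G → y ∈V G → x ≢ y → BothParities G x y
  oddCycle⇒BothParities {G} G⊆F ((v , rest , len≥3 , u , edgeSet) , rainbow , _) x∈ y∈ x≢y n
    with oddCircuit⇒PathWithin C circuit oddC (onC x∈) (onC y∈) x≢y n
    where
    vs : List Vertex
    vs = v ∷ rest ++ [ v ]
    w : Walk (EdgeBetween G) vs
    w = walk-EdgeSetIs vs edgeSet
    C : List CEdge
    C = edgesAlong vs w
    chain : Chain v v C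
    chain = subst (λ z → Chain v z C) (last-∷ʳ v rest v) (chain-edgesAlong v (rest ++ [ v ]) w)
    sources≡ : sources C ≡ v ∷ rest
    sources≡ = ∷ʳ-injectiveˡ (sources C) (v ∷ rest) (trans (sources-∷ʳ C chain) (vertices-edgesAlong v (rest ++ [ v ]) w))
    circuit : RainbowCircuit G v C
    circuit = chain , edgesAlong⊆ vs w , subst Unique (sym sources≡) u ,
              Unique-colors-edgesAlong vs w (Rainbow⇒Unique-colors rainbow) (Unique⇒DistinctEdges-cycle v rest u len≥3)
    oddC : Odd (length C)
    oddC = RainbowCircuit-odd wfF noEven C (RainbowCircuit-mono G⊆F circuit) C≢[]
      where
      C≢[] : C ≢ []
      C≢[] C≡[] with () ← subst (λ es → sources es ≡ v ∷ rest) C≡[] sources≡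
    onC : ∀ {z} → z ∈V G → z ∈ sources C
    onC z∈ with ∈-++⁻ (v ∷ rest) (V⊆-EdgeSetIs vs edgeSet z∈)
    ... | inj₁ z∈′ = subst (_ ∈_) (sym sources≡) z∈′
    ... | inj₂ (here refl) = subst (_ ∈_) (sym sources≡) (here refl)
  ... | p , rp , even , _ = p , rp , even

BothParities-reverse : ∀ {G x y} → BothParities G y x → BothParities G x y
BothParities-reverse both n with both n
... | es , rp , even = reverseChain es , RainbowPath-reverse es rp , subst (λ k → Even (n + k)) (sym (length-reverseChain es)) even

module Theta {F B : ColGraph} (wfF : WF F) (noEven : NoEvenRainbowCycle F) (B⊆F : B ⊆ᶜ F)
  {s t : Vertex} (s≢t : s ≢ t) where

  MeetAtEnds : List Vertex → List Vertex → Set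
  MeetAtEnds A A′ = ∀ {v} → v ∈ A → v ∈ A′ → v ≡ s ⊎ v ≡ t

  -- Two internally disjoint, colour-disjoint rainbow s–t paths form a rainbow cycle, odd by (F2).
  module Circuit (a b : List CEdge) (pa : RainbowPath B s t a) (pb : RainbowPath B s t b)
    (meet : MeetAtEnds (vertices s a) (vertices s b)) (colors-disjoint : Disjoint (colors a) (colors b)) where

    private
      b⁻ : List CEdge
      b⁻ = reverseChain b
      pb⁻ : RainbowPath B t s b⁻
      pb⁻ = RainbowPath-reverse b pb
      onReversed : ∀ {v} → v ∈ sources b⁻ → v ∈ vertices s b
      onReversed v∈ = ∈-vertices-reverseChain b (proj₁ pb) (sources⊆vertices b⁻ (proj₁ pb⁻) v∈)

    C : List CEdge
    C = a ++ b⁻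

    sources≡ : sources C ≡ sources a ++ sources b⁻
    sources≡ = map-++ src a b⁻

    colors≡ : colors C ≡ colors a ++ colors b⁻
    colors≡ = map-++ color a b⁻

    circuit : RainbowCircuit B s C
    circuit = chain-++ a (proj₁ pa) (proj₁ pb⁻) , AllP.++⁺ (proj₁ (proj₂ pa)) (proj₁ (proj₂ pb⁻)) ,
      subst Unique (sym sources≡) (Unique.++⁺ (Unique-sources a pa) (Unique-sources b⁻ pb⁻) internallyDisjoint) ,
      subst Unique (sym colors≡) (Unique.++⁺ (proj₂ (proj₂ (proj₂ pa))) (proj₂ (proj₂ (proj₂ pb⁻)))
        λ (α∈a , α∈b⁻) → colors-disjoint (α∈a , ∈-colors-reverseChain b α∈b⁻))
      where
      internallyDisjoint : Disjoint (sources a) (sources b⁻)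
      internallyDisjoint (v∈a , v∈b⁻) with meet (sources⊆vertices a (proj₁ pa) v∈a) (onReversed v∈b⁻)
      ... | inj₁ refl = end∉sources b⁻ pb⁻ v∈b⁻
      ... | inj₂ refl = end∉sources a pa v∈a

    odd : Odd (length C)
    odd = RainbowCircuit-odd wfF noEven C (RainbowCircuit-mono B⊆F circuit) C≢[]
      where
      C≢[] : C ≢ []
      C≢[] C≡[] = Chain⇒≢[] a (proj₁ pa) s≢t (++-conicalˡ a b⁻ C≡[])

    onC : ∀ {v} → v ∈ vertices s a ⊎ v ∈ vertices s b → v ∈ sources C
    onC (inj₁ v∈) with vertices⊆sources∷ʳ a (proj₁ pa) v∈
    ... | inj₁ v∈a = subst (_ ∈_) (sym sources≡) (∈-++⁺ˡ v∈a)
    ... | inj₂ refl = subst (_ ∈_) (sym sources≡) (∈-++⁺ʳ (sources a) (start∈sources b⁻ (proj₁ pb⁻) (λ e → s≢t (sym e))))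
    onC (inj₂ v∈) with vertices⊆sources∷ʳ b⁻ (proj₁ pb⁻) (subst (_ ∈_) (sym (vertices-reverseChain b (proj₁ pb))) (reverse⁺ v∈))
    ... | inj₁ v∈b⁻ = subst (_ ∈_) (sym sources≡) (∈-++⁺ʳ (sources a) v∈b⁻)
    ... | inj₂ refl = subst (_ ∈_) (sym sources≡) (∈-++⁺ˡ (start∈sources a (proj₁ pa) s≢t))

    offC : ∀ {v} → v ∈ sources C → v ∈ vertices s a ⊎ v ∈ vertices s b
    offC v∈ with ∈-++⁻ (sources a) (subst (_ ∈_) sources≡ v∈)
    ... | inj₁ v∈a = inj₁ (sources⊆vertices a (proj₁ pa) v∈a)
    ... | inj₂ v∈b⁻ = inj₂ (onReversed v∈b⁻)

    colorsOffC : ∀ {α} → α ∈ colors C → α ∈ colors a ⊎ α ∈ colors b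
    colorsOffC α∈ with ∈-++⁻ (colors a) (subst (_ ∈_) colors≡ α∈)
    ... | inj₁ α∈a = inj₁ α∈a
    ... | inj₂ α∈b⁻ = inj₂ (∈-colors-reverseChain b α∈b⁻)

    pathWithin : ∀ {x y} → x ∈ vertices s a ⊎ x ∈ vertices s b → y ∈ vertices s a ⊎ y ∈ vertices s b → x ≢ y →
      ∀ n → PathWithin B C n x y
    pathWithin x∈ y∈ = oddCircuit⇒PathWithin C circuit odd (onC x∈) (onC y∈)

    bothParities : ∀ {x y} → x ∈ vertices s a ⊎ x ∈ vertices s b → y ∈ vertices s a ⊎ y ∈ vertices s b → x ≢ y →
      BothParities B x y
    bothParities x∈ y∈ x≢y n with pathWithin x∈ y∈ x≢y n
    ... | p , rp , even , _ = p , rp , even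

  module ThreeArcs (c₁ c₂ c₃ : List CEdge)
    (p₁ : RainbowPath B s t c₁) (p₂ : RainbowPath B s t c₂) (p₃ : RainbowPath B s t c₃)
    (meet₁₂ : MeetAtEnds (vertices s c₁) (vertices s c₂))
    (meet₁₃ : MeetAtEnds (vertices s c₁) (vertices s c₃))
    (meet₂₃ : MeetAtEnds (vertices s c₂) (vertices s c₃))
    (disjoint₁₃ : Disjoint (colors c₁) (colors c₃)) (disjoint₂₃ : Disjoint (colors c₂) (colors c₃))
    (shared₁₂-unique : ∀ {α β} → α ∈ colors c₁ → α ∈ colors c₂ → β ∈ colors c₁ → β ∈ colors c₂ → α ≡ β)
    where

    private
      A₁ A₂ A₃ : List Vertex
      A₁ = vertices s c₁
      A₂ = vertices s c₂
      A₃ = vertices s c₃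

    module C₁₃ = Circuit c₁ c₃ p₁ p₃ meet₁₃ disjoint₁₃
    module C₂₃ = Circuit c₂ c₃ p₂ p₃ meet₂₃ disjoint₂₃

    t∈A₃ : t ∈ A₃
    t∈A₃ = end∈vertices c₃ (proj₁ p₃)

    -- The odd cycle c₂ ∪ c₃ continues tl to y with either parity.
    extend : ∀ {x z y} tl → RainbowPath B x z tl → z ∈ A₃ → y ∈ A₂ → y ∉ A₃ →
      (∀ {v} → v ∈ sources tl → v ∈ A₁ × v ≢ s × v ≢ t) →
      (∀ {α} → α ∈ colors tl → α ∈ colors c₁ × α ∉ colors c₂) → BothParities B x y
    extend {z = z} tl ptl z∈₃ y∈₂ y∉₃ tlVertices tlColors n
      with C₂₃.pathWithin (inj₂ z∈₃) (inj₁ y∈₂) (λ z≡y → y∉₃ (subst (_∈ A₃) z≡y z∈₃)) (n + length tl)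
    ... | arc , parc , even , arcVertices , arcColors =
      tl ++ arc , RainbowPath-++ tl arc ptl parc vertexDisjoint colorDisjoint ,
      subst Even (trans (+-assoc n (length tl) (length arc)) (cong (n +_) (sym (length-++ tl)))) even
      where
      vertexDisjoint : Disjoint (sources tl) (vertices z arc)
      vertexDisjoint (v∈tl , v∈arc) with tlVertices v∈tl | C₂₃.offC (arcVertices v∈arc)
      ... | v∈₁ , v≢s , v≢t | inj₁ v∈₂ = [ v≢s , v≢t ]′ (meet₁₂ v∈₁ v∈₂)
      ... | v∈₁ , v≢s , v≢t | inj₂ v∈₃ = [ v≢s , v≢t ]′ (meet₁₃ v∈₁ v∈₃)
      colorDisjoint : Disjoint (colors tl) (colors arc)
      colorDisjoint (α∈tl , α∈arc) with tlColors α∈tl | C₂₃.colorsOffC (arcColors α∈arc)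
      ... | _ , α∉₂ | inj₁ α∈₂ = α∉₂ α∈₂
      ... | α∈₁ , _ | inj₂ α∈₃ = disjoint₁₃ (α∈₁ , α∈₃)

    -- Cut c₁ at x; the piece containing no colour of c₂ leads from x to c₃.
    cross : ∀ {x y} → x ∈ A₁ → x ∉ A₃ → y ∈ A₂ → y ∉ A₃ → BothParities B x y
    cross {x} {y} x∈₁ x∉₃ y∈₂ y∉₃ with vertices⊆sources∷ʳ c₁ (proj₁ p₁) x∈₁
    ... | inj₂ refl = ⊥-elim (x∉₃ t∈A₃)
    ... | inj₁ x∈c₁ with RainbowPath-split c₁ p₁ x∈c₁
    ... | L , R , refl , pL , pR = viaUncoloredPiece (any? (λ α → any? (α ≟_) (colors c₂)) (colors L))
      where
      inColors : ∀ {β} → β ∈ colors L ⊎ β ∈ colors R → β ∈ colors (L ++ R)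
      inColors = ∈-map-++⁺ color L
      inSources : ∀ {v} → v ∈ sources L ⊎ v ∈ sources R → v ∈ sources (L ++ R)
      inSources = ∈-map-++⁺ src L
      inA₁ : ∀ {v} → v ∈ sources L ⊎ v ∈ sources R → v ∈ A₁
      inA₁ v∈ = sources⊆vertices (L ++ R) (proj₁ p₁) (inSources v∈)
      t∉c₁ : ∀ {v} → v ∈ sources L ⊎ v ∈ sources R → v ≢ t
      t∉c₁ v∈ refl = end∉sources (L ++ R) p₁ (inSources v∈)

      viaUncoloredPiece : Dec (Any (_∈ colors c₂) (colors L)) → BothParities B x y
      viaUncoloredPiece (yes shared) with find shared
      ... | α , α∈L , α∈₂ = extend R pR t∈A₃ y∈₂ y∉₃ onR colorsR
        where
        onR : ∀ {v} → v ∈ sources R → v ∈ A₁ × v ≢ s × v ≢ t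
        onR v∈R = inA₁ (inj₂ v∈R) ,
                  (λ { refl → Unique-map-++⇒Disjoint src L (Unique-sources (L ++ R) p₁) (start∈sources L (proj₁ pL) s≢x , v∈R) }) ,
                  t∉c₁ (inj₂ v∈R)
          where
          s≢x : s ≢ x
          s≢x s≡x = x∉₃ (subst (_∈ A₃) s≡x (here refl))
        twice : ∀ {β} → α ≡ β → β ∈ colors R → ⊥
        twice refl β∈R = Unique-map-++⇒Disjoint color L (proj₂ (proj₂ (proj₂ p₁))) (α∈L , β∈R)
        colorsR : ∀ {β} → β ∈ colors R → β ∈ colors c₁ × β ∉ colors c₂
        colorsR β∈R = inColors (inj₂ β∈R) , λ β∈₂ → twice (shared₁₂-unique (inColors (inj₁ α∈L)) α∈₂ (inColors (inj₂ β∈R)) β∈₂) β∈R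
      viaUncoloredPiece (no unshared) = extend L⁻ pL⁻ (here refl) y∈₂ y∉₃ onL⁻ colorsL⁻
        where
        L⁻ : List CEdge
        L⁻ = reverseChain L
        pL⁻ : RainbowPath B x s L⁻
        pL⁻ = RainbowPath-reverse L pL
        onL⁻ : ∀ {v} → v ∈ sources L⁻ → v ∈ A₁ × v ≢ s × v ≢ t
        onL⁻ v∈ with vertices⊆sources∷ʳ L (proj₁ pL) (∈-vertices-reverseChain L (proj₁ pL) (sources⊆vertices L⁻ (proj₁ pL⁻) v∈))
        ... | inj₁ v∈L = inA₁ (inj₁ v∈L) , (λ { refl → end∉sources L⁻ pL⁻ v∈ }) , t∉c₁ (inj₁ v∈L)
        ... | inj₂ refl = x∈₁ , (λ { refl → x∉₃ (here refl) }) , (λ { refl → x∉₃ t∈A₃ })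
        colorsL⁻ : ∀ {β} → β ∈ colors L⁻ → β ∈ colors c₁ × β ∉ colors c₂
        colorsL⁻ β∈ = inColors (inj₁ (∈-colors-reverseChain L β∈)) , λ β∈₂ → unshared (lose (∈-colors-reverseChain L β∈) β∈₂)

    private
      mixed : ∀ {x y} → x ∈ A₁ → y ∈ A₂ → x ≢ y → BothParities B x y
      mixed {x} {y} x∈₁ y∈₂ x≢y with any? (x ≟_) A₃ | any? (y ≟_) A₃
      ... | yes x∈₃ | _ = C₂₃.bothParities (inj₂ x∈₃) (inj₁ y∈₂) x≢y
      ... | no _ | yes y∈₃ = C₁₃.bothParities (inj₁ x∈₁) (inj₂ y∈₃) x≢y
      ... | no x∉₃ | no y∉₃ = cross x∈₁ x∉₃ y∈₂ y∉₃

    bothParities : ∀ {x y} → x ∈ A₁ ⊎ x ∈ A₂ ⊎ x ∈ A₃ → y ∈ A₁ ⊎ y ∈ A₂ ⊎ y ∈ A₃ → x ≢ y → BothParities B x y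
    bothParities (inj₁ x∈₁) (inj₁ y∈₁) = C₁₃.bothParities (inj₁ x∈₁) (inj₁ y∈₁)
    bothParities (inj₁ x∈₁) (inj₂ (inj₁ y∈₂)) = mixed x∈₁ y∈₂
    bothParities (inj₁ x∈₁) (inj₂ (inj₂ y∈₃)) = C₁₃.bothParities (inj₁ x∈₁) (inj₂ y∈₃)
    bothParities (inj₂ (inj₁ x∈₂)) (inj₁ y∈₁) x≢y = BothParities-reverse (mixed y∈₁ x∈₂ (λ y≡x → x≢y (sym y≡x)))
    bothParities (inj₂ (inj₁ x∈₂)) (inj₂ (inj₁ y∈₂)) = C₂₃.bothParities (inj₁ x∈₂) (inj₁ y∈₂)
    bothParities (inj₂ (inj₁ x∈₂)) (inj₂ (inj₂ y∈₃)) = C₂₃.bothParities (inj₁ x∈₂) (inj₂ y∈₃)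
    bothParities (inj₂ (inj₂ x∈₃)) (inj₁ y∈₁) = C₁₃.bothParities (inj₂ x∈₃) (inj₁ y∈₁)
    bothParities (inj₂ (inj₂ x∈₃)) (inj₂ (inj₁ y∈₂)) = C₂₃.bothParities (inj₂ x∈₃) (inj₁ y∈₂)
    bothParities (inj₂ (inj₂ x∈₃)) (inj₂ (inj₂ y∈₃)) = C₁₃.bothParities (inj₂ x∈₃) (inj₂ y∈₃)

module BadPiece {F B : ColGraph} (wfF : WF F) (noEven : NoEvenRainbowCycle F) (B⊆F : B ⊆ᶜ F)
  (almostRainbow : AlmostRainbow B) {s t : Vertex} (s≢t : s ≢ t) where

  open Theta wfF noEven B⊆F s≢t

  record Arc : Set where
    field
      path : ColGraph
      chain : List CEdge
      path⊆B : path ⊆ᶜ B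
      onPath : RainbowPath path s t chain
      inPath : ∀ {v} → v ∈ vertices s chain → v ∈V path
      onChain : ∀ {v} → v ∈V path → v ∈ vertices s chain

  open Arc

  arc : ∀ {P} → IsPathBetween s t P → Rainbow P → P ⊆ᶜ B → Arc
  arc {P} pathBetween@(mid , _ , edgeSet) rainbow P⊆B
    with IsPathBetween⇒RainbowPath (Rainbow⇒Unique-colors rainbow) (λ _ e∈ → e∈) pathBetween
  ... | c , rp , vertices≡ = record
    { path = P ; chain = c ; path⊆B = P⊆B ; onPath = rp
    ; inPath = λ {v} v∈ → ⊆V-EdgeSetIs (s ∷ mid ++ [ t ]) edgeSet (length≥2 mid) (subst (v ∈_) vertices≡ v∈)
    ; onChain = λ {v} v∈ → subst (v ∈_) (sym vertices≡) (V⊆-EdgeSetIs (s ∷ mid ++ [ t ]) edgeSet v∈)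
    }
    where
    length≥2 : ∀ (xs : List Vertex) → 2 ≤ length (s ∷ xs ++ [ t ])
    length≥2 [] = s≤s (s≤s z≤n)
    length≥2 (_ ∷ _) = s≤s (s≤s z≤n)

  onB : ∀ a → RainbowPath B s t (chain a)
  onB a = RainbowPath-mono (path⊆B a) (onPath a)

  A : Arc → List Vertex
  A a = vertices s (chain a)

  record Apart (a b : Arc) : Set where
    field
      meet : MeetAtEnds (A a) (A b)
      edgeDisjoint : ∀ {e} → e ∈ path a → ¬ (edge e ∈ᵉ path b)

  open Apart

  apart : ∀ a b → (∀ x → x ∈V path a → x ∈V path b → x ≡ s ⊎ x ≡ t) →
    (∀ e → Any (λ f → f ≡ e) (path a) → ¬ (edge e ∈ᵉ path b)) → Apart a b
  apart a b shareVertices shareEdges = record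
    { meet = λ v∈a v∈b → shareVertices _ (inPath a v∈a) (inPath b v∈b)
    ; edgeDisjoint = λ e∈ → shareEdges _ (Any.map sym e∈) }

  Apart-sym : ∀ {a b} → Apart a b → Apart b a
  Apart-sym ab = record
    { meet = λ v∈b v∈a → meet ab v∈a v∈b
    ; edgeDisjoint = λ f∈b onA → case find onA of λ (g , g∈a , s) →
        edgeDisjoint ab g∈a (lose f∈b (SameEdge-sym s)) }

  record Carrier (a : Arc) (α : Color) : Set where
    field
      edgeᴮ : CEdge
      edgeᴮ∈B : edgeᴮ ∈ B
      colored : color edgeᴮ ≡ α
      onArc : edge edgeᴮ ∈ᵉ path a

  open Carrier

  carrier : ∀ a {α} → α ∈ colors (chain a) → Carrier a α
  carrier a α∈ with ∈-map⁻ color α∈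
  ... | f , f∈ , refl with find (All.lookup (proj₁ (proj₂ (onPath a))) f∈)
  ... | g , g∈P , (_ , c₁) with find (path⊆B a g (∈⇒∈ᶜ g∈P))
  ... | h , h∈B , (s₂ , c₂) = record
    { edgeᴮ = h ; edgeᴮ∈B = h∈B ; colored = sym (trans c₁ c₂) ; onArc = lose g∈P (SameEdge-sym s₂) }

  Carrier-distinct : ∀ {a b α β} → Apart a b → (w : Carrier a α) (w′ : Carrier b β) → edgeᴮ w ≢ edgeᴮ w′
  Carrier-distinct ab w w′ eq with find (onArc w)
  ... | f , f∈a , s = edgeDisjoint ab f∈a (Any.map (SameEdge-trans (SameEdge-sym s)) (subst (λ g → edge g ∈ᵉ _) (sym eq) (onArc w′)))

  Carrier-colors : ∀ {a b α β} (w : Carrier a α) (w′ : Carrier b β) → α ≢ β → edgeᴮ w ≢ edgeᴮ w′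
  Carrier-colors w w′ α≢β eq = α≢β (trans (sym (colored w)) (trans (cong color eq) (colored w′)))

  -- B has exactly one repeated colour, so it cannot contain two different same-coloured pairs.
  twoCollisions : ∀ {u₁ u₂ u₃ u₄} → u₁ ∈ B → u₂ ∈ B → u₃ ∈ B → u₄ ∈ B →
    u₁ ≢ u₂ → u₃ ≢ u₄ → u₃ ≢ u₁ → u₃ ≢ u₂ → color u₁ ≡ color u₂ → color u₃ ≡ color u₄ → ⊥
  twoCollisions m₁ m₂ m₃ m₄ n₁₂ n₃₄ n₃₁ n₃₂ e₁₂ e₃₄ =
    <-irrefl refl (subst (suc (suc (numColors B)) ≤_) (sym almostRainbow)
      (twoCollisions⇒length-dedup< color m₁ m₂ m₃ m₄ n₁₂ n₃₄ n₃₁ n₃₂ e₁₂ e₃₄))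

  Shared : Arc → Arc → Color → Set
  Shared a b α = α ∈ colors (chain a) × α ∈ colors (chain b)

  Shared-unique : ∀ {a b α β} → Apart a b → Shared a b α → Shared a b β → α ≡ β
  Shared-unique {a} {b} {α} {β} ab (α∈a , α∈b) (β∈a , β∈b) with α ≟ β
  ... | yes α≡β = α≡β
  ... | no α≢β = ⊥-elim (twoCollisions (edgeᴮ∈B w₁) (edgeᴮ∈B w₂) (edgeᴮ∈B w₃) (edgeᴮ∈B w₄)
      (Carrier-distinct ab w₁ w₂) (Carrier-distinct ab w₃ w₄)
      (Carrier-colors w₃ w₁ (λ β≡α → α≢β (sym β≡α))) (Carrier-colors w₃ w₂ (λ β≡α → α≢β (sym β≡α)))
      (trans (colored w₁) (sym (colored w₂))) (trans (colored w₃) (sym (colored w₄))))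
    where
    w₁ : Carrier a α
    w₁ = carrier a α∈a
    w₂ : Carrier b α
    w₂ = carrier b α∈b
    w₃ : Carrier a β
    w₃ = carrier a β∈a
    w₄ : Carrier b β
    w₄ = carrier b β∈b

  twoSharedPairs : ∀ {a b c d α β} → Apart a b → Apart c a → Apart c b → Apart c d →
    Shared a b α → Shared c d β → ⊥
  twoSharedPairs {a} {b} {c} {d} {α} {β} ab ca cb cd (α∈a , α∈b) (β∈c , β∈d) =
    twoCollisions (edgeᴮ∈B w₁) (edgeᴮ∈B w₂) (edgeᴮ∈B w₃) (edgeᴮ∈B w₄)
      (Carrier-distinct ab w₁ w₂) (Carrier-distinct cd w₃ w₄) (Carrier-distinct ca w₃ w₁) (Carrier-distinct cb w₃ w₂)
      (trans (colored w₁) (sym (colored w₂))) (trans (colored w₃) (sym (colored w₄)))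
    where
    w₁ : Carrier a α
    w₁ = carrier a α∈a
    w₂ : Carrier b α
    w₂ = carrier b α∈b
    w₃ : Carrier c β
    w₃ = carrier c β∈c
    w₄ : Carrier d β
    w₄ = carrier d β∈d

  bothParities : ∀ a b c → Apart a b → Apart a c → Apart b c →
    Disjoint (colors (chain a)) (colors (chain c)) → Disjoint (colors (chain b)) (colors (chain c)) →
    ∀ {x y} → x ∈ A a ⊎ x ∈ A b ⊎ x ∈ A c → y ∈ A a ⊎ y ∈ A b ⊎ y ∈ A c → x ≢ y → BothParities B x y
  bothParities a b c ab ac bc disjoint-ac disjoint-bc =
    ThreeArcs.bothParities (chain a) (chain b) (chain c) (onB a) (onB b) (onB c) (meet ab) (meet ac) (meet bc)
      disjoint-ac disjoint-bc (λ α∈a α∈b β∈a β∈b → Shared-unique ab (α∈a , α∈b) (β∈a , β∈b))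

  private
    sharesColor? : ∀ a b → Dec (Any (_∈ colors (chain b)) (colors (chain a)))
    sharesColor? a b = any? (λ α → any? (α ≟_) (colors (chain b))) (colors (chain a))

    disjoint : ∀ a b → ¬ Any (_∈ colors (chain b)) (colors (chain a)) → Disjoint (colors (chain a)) (colors (chain b))
    disjoint _ _ none (α∈a , α∈b) = none (lose α∈a α∈b)

    shared : ∀ a b → Any (_∈ colors (chain b)) (colors (chain a)) → ∃ (Shared a b)
    shared _ _ some with find some
    ... | α , α∈a , α∈b = α , α∈a , α∈b

  -- At most one pair of arcs shares a colour; the arc outside that pair plays the role of c₃.
  theta⇒BothParities : ∀ {P₁ P₂ P₃} → IsThetaWith s t P₁ P₂ P₃ B → Rainbow P₁ → Rainbow P₂ → Rainbow P₃ →
    ∀ {x y} → x ∈V B → y ∈V B → x ≢ y → BothParities B x y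
  theta⇒BothParities (_ , _ , _ , pb₁ , pb₂ , pb₃ , covered , included , (V₁₂ , E₁₂) , (V₁₃ , E₁₃) , (V₂₃ , E₂₃))
    rb₁ rb₂ rb₃ {x} {y} x∈ y∈ x≢y = byShared (sharesColor? a₁ a₃) (sharesColor? a₂ a₃) (sharesColor? a₁ a₂)
    where
    a₁ a₂ a₃ : Arc
    a₁ = arc pb₁ rb₁ (λ e e∈ → included e (inj₁ e∈))
    a₂ = arc pb₂ rb₂ (λ e e∈ → included e (inj₂ (inj₁ e∈)))
    a₃ = arc pb₃ rb₃ (λ e e∈ → included e (inj₂ (inj₂ e∈)))
    ap₁₂ : Apart a₁ a₂
    ap₁₂ = apart a₁ a₂ V₁₂ E₁₂
    ap₁₃ : Apart a₁ a₃
    ap₁₃ = apart a₁ a₃ V₁₃ E₁₃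
    ap₂₃ : Apart a₂ a₃
    ap₂₃ = apart a₂ a₃ V₂₃ E₂₃

    cover : ∀ {z} → z ∈V B → z ∈ A a₁ ⊎ z ∈ A a₂ ⊎ z ∈ A a₃
    cover z∈ with find z∈
    ... | e , e∈ , z∈e with covered e (∈⇒∈ᶜ e∈)
    ... | inj₁ e∈₁ = inj₁ (onChain a₁ (∈ᶜ⇒∈V e∈₁ z∈e))
    ... | inj₂ (inj₁ e∈₂) = inj₂ (inj₁ (onChain a₂ (∈ᶜ⇒∈V e∈₂ z∈e)))
    ... | inj₂ (inj₂ e∈₃) = inj₂ (inj₂ (onChain a₃ (∈ᶜ⇒∈V e∈₃ z∈e)))

    byShared : Dec (Any (_∈ colors (chain a₃)) (colors (chain a₁))) → Dec (Any (_∈ colors (chain a₃)) (colors (chain a₂))) →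
      Dec (Any (_∈ colors (chain a₂)) (colors (chain a₁))) → BothParities B x y
    byShared (yes s₁₃) _ (yes s₁₂) with shared a₁ a₃ s₁₃ | shared a₁ a₂ s₁₂
    ... | _ , α∈₁ , α∈₃ | _ , β∈₁ , β∈₂ = ⊥-elim (twoSharedPairs ap₁₃ (Apart-sym ap₁₂) ap₂₃ (Apart-sym ap₁₂) (α∈₁ , α∈₃) (β∈₂ , β∈₁))
    byShared (yes s₁₃) (yes s₂₃) (no _) with shared a₁ a₃ s₁₃ | shared a₂ a₃ s₂₃
    ... | _ , α∈₁ , α∈₃ | _ , β∈₂ , β∈₃ = ⊥-elim (twoSharedPairs ap₁₃ (Apart-sym ap₁₂) ap₂₃ ap₂₃ (α∈₁ , α∈₃) (β∈₂ , β∈₃))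
    byShared (yes _) (no d₂₃) (no d₁₂) =
      bothParities a₁ a₃ a₂ ap₁₃ ap₁₂ (Apart-sym ap₂₃) (disjoint a₁ a₂ d₁₂) (Disjoint.sym (disjoint a₂ a₃ d₂₃))
        (map₂ swap (cover x∈)) (map₂ swap (cover y∈)) x≢y
    byShared (no _) (yes s₂₃) (yes s₁₂) with shared a₂ a₃ s₂₃ | shared a₁ a₂ s₁₂
    ... | _ , α∈₂ , α∈₃ | _ , β∈₁ , β∈₂ = ⊥-elim (twoSharedPairs ap₂₃ ap₁₂ ap₁₃ ap₁₂ (α∈₂ , α∈₃) (β∈₁ , β∈₂))
    byShared (no d₁₃) (yes _) (no d₁₂) =
      bothParities a₂ a₃ a₁ ap₂₃ (Apart-sym ap₁₂) (Apart-sym ap₁₃) (Disjoint.sym (disjoint a₁ a₂ d₁₂)) (Disjoint.sym (disjoint a₁ a₃ d₁₃))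
        (assocʳ (swap (cover x∈))) (assocʳ (swap (cover y∈))) x≢y
    byShared (no d₁₃) (no d₂₃) _ =
      bothParities a₁ a₂ a₃ ap₁₂ ap₁₃ ap₂₃ (disjoint a₁ a₃ d₁₃) (disjoint a₂ a₃ d₂₃) (cover x∈) (cover y∈) x≢y

badPiece⇒BothParities : ∀ {F B x y} → WF F → NoEvenRainbowCycle F → B ⊆ᶜ F → IsBadPiece B →
  x ∈V B → y ∈V B → x ≢ y → BothParities B x y
badPiece⇒BothParities wfF noEven B⊆F
  (almostRainbow , (s , t , _ , _ , _ , theta@(_ , _ , _ , (mid , s∉ ∷ _ , _) , _) , rb₁ , rb₂ , rb₃) , _) =
  BadPiece.theta⇒BothParities wfF noEven B⊆F almostRainbow s≢t theta rb₁ rb₂ rb₃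
  where
  s≢t : s ≢ t
  s≢t = All.lookup s∉ (∈-++⁺ʳ mid (here refl))

-- Cycles of G(𝔉)

module _ {F : ColGraph} (wfF : WF F) (noEven : NoEvenRainbowCycle F) where

  piece⇒RainbowPath : ∀ k {G x y} → FitsKind k G → G ⊆ᶜ F → x ∈V G → y ∈V G → x ≢ y → ∃ (RainbowPath G x y)
  piece⇒RainbowPath cycleK fits G⊆F x∈ y∈ x≢y with oddCycle⇒BothParities wfF noEven G⊆F fits x∈ y∈ x≢y 0
  ... | es , rp , _ = es , rp
  piece⇒RainbowPath badK fits G⊆F x∈ y∈ x≢y with badPiece⇒BothParities wfF noEven G⊆F fits x∈ y∈ x≢y 0
  ... | es , rp , _ = es , rp
  piece⇒RainbowPath treeK (tree , rainbow) _ = tree⇒RainbowPath tree rainbow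

  nonTreePiece⇒BothParities : ∀ k {G x y} → k ≢ treeK → FitsKind k G → G ⊆ᶜ F → x ∈V G → y ∈V G → x ≢ y → BothParities G x y
  nonTreePiece⇒BothParities cycleK _ fits G⊆F = oddCycle⇒BothParities wfF noEven G⊆F fits
  nonTreePiece⇒BothParities badK _ fits G⊆F = badPiece⇒BothParities wfF noEven G⊆F fits
  nonTreePiece⇒BothParities treeK k≢treeK = ⊥-elim (k≢treeK refl)

module Frankenstein {F : ColGraph} {m : ℕ} {Gs : Fin m → ColGraph} {κ : Fin m → Kind}
  (frankenstein : IsFrankenstein F m Gs κ) where

  private
    wfF : WF F
    wfF = proj₁ frankenstein
    partition : IsPartition F m Gs
    partition = proj₁ (proj₂ (proj₂ frankenstein))
    fits : ∀ i → FitsKind (κ i) (Gs i)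
    fits = proj₁ (proj₂ (proj₂ (proj₂ frankenstein)))
    treesDisjoint : ∀ i j → i ≢ j → κ i ≡ treeK → κ j ≡ treeK → ∀ x → x ∈V Gs i → x ∈V Gs j → ⊥
    treesDisjoint = proj₁ (proj₂ (proj₂ (proj₂ (proj₂ frankenstein))))
    noEven : NoEvenRainbowCycle F
    noEven = proj₂ (proj₂ (proj₂ (proj₂ (proj₂ frankenstein))))
    Gs⊆F : ∀ i → Gs i ⊆ᶜ F
    Gs⊆F i e e∈ = proj₁ (proj₂ (proj₂ partition)) e i e∈
    oneSharedVertex : ∀ {i j} → i ≢ j → ∀ {x y} → x ∈V Gs i → x ∈V Gs j → y ∈V Gs i → y ∈V Gs j → x ≡ y
    oneSharedVertex i≢j = proj₁ (proj₂ (proj₂ (proj₂ partition))) _ _ i≢j _ _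
    noSharedColor : ∀ {i j} → i ≢ j → ∀ {α} → α ∈χ Gs i → α ∈χ Gs j → ⊥
    noSharedColor i≢j = proj₂ (proj₂ (proj₂ (proj₂ partition))) _ _ i≢j _

  record Leg : Set where
    field
      piece : Fin m
      from to : Vertex
      edges : List CEdge
      path : RainbowPath (Gs piece) from to edges
      from≢to : from ≢ to

  open Leg

  vertices∈piece : ∀ l {v} → v ∈ vertices (from l) (edges l) → v ∈V Gs (piece l)
  vertices∈piece l = vertices⊆V (edges l) (path l) (from≢to l)

  from∈piece : ∀ l → from l ∈V Gs (piece l)
  from∈piece l = vertices∈piece l (here refl)

  to∈piece : ∀ l → to l ∈V Gs (piece l)
  to∈piece l = vertices∈piece l (end∈vertices (edges l) (proj₁ (path l)))

  sources∈piece : ∀ l {v} → v ∈ sources (edges l) → v ∈V Gs (piece l)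
  sources∈piece l v∈ = vertices∈piece l (sources⊆vertices (edges l) (proj₁ (path l)) v∈)

  Linked : Vertex → List Leg → Set
  Linked p [] = ⊤
  Linked p (l ∷ S) = from l ≡ p × Linked (to l) S

  lastTo : Vertex → List Leg → Vertex
  lastTo p [] = p
  lastTo p (l ∷ S) = lastTo (to l) S

  lastTo-++ : ∀ p xs ys → lastTo p (xs ++ ys) ≡ lastTo (lastTo p xs) ys
  lastTo-++ p [] ys = refl
  lastTo-++ p (l ∷ xs) ys = lastTo-++ (to l) xs ys

  Linked-++⁻ : ∀ p xs {ys} → Linked p (xs ++ ys) → Linked p xs × Linked (lastTo p xs) ys
  Linked-++⁻ p [] linked = tt , linked
  Linked-++⁻ p (l ∷ xs) (eq , linked) with Linked-++⁻ (to l) xs linked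
  ... | lxs , lys = (eq , lxs) , lys

  Linked-++⁺ : ∀ p xs {ys} → Linked p xs → Linked (lastTo p xs) ys → Linked p (xs ++ ys)
  Linked-++⁺ p [] _ lys = lys
  Linked-++⁺ p (l ∷ xs) (eq , lxs) lys = eq , Linked-++⁺ (to l) xs lxs lys

  -- A cycle of G(𝔉) as a closed walk with one leg per piece. Consecutive legs need only meet in some vertex
  -- (not necessarily of V₂), so that the shortcuts below stay in this class.
  record LegCycle (S : List Leg) : Set where
    field
      long : 2 ≤ length S
      base : Vertex
      linked : Linked base S
      closed : lastTo base S ≡ base
      distinctPieces : Unique (map piece S)
      distinctStops : Unique (map to S)

  open LegCycle

  LegCycle-rotate : ∀ xs ys → LegCycle (xs ++ ys) → LegCycle (ys ++ xs)
  LegCycle-rotate xs ys cyc = record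
    { long = subst (2 ≤_) (trans (length-++ xs) (trans (+-comm (length xs) (length ys)) (sym (length-++ ys)))) (long cyc)
    ; base = lastTo (base cyc) xs
    ; linked = Linked-++⁺ _ ys lys (subst (λ p → Linked p xs) (sym closes) lxs)
    ; closed = trans (lastTo-++ _ ys xs) (cong (λ p → lastTo p xs) closes)
    ; distinctPieces = Unique-map-++-comm piece xs ys (distinctPieces cyc)
    ; distinctStops = Unique-map-++-comm to xs ys (distinctStops cyc)
    }
    where
    lxs : Linked (base cyc) xs
    lxs = proj₁ (Linked-++⁻ (base cyc) xs (linked cyc))
    lys : Linked (lastTo (base cyc) xs) ys
    lys = proj₂ (Linked-++⁻ (base cyc) xs (linked cyc))
    closes : lastTo (lastTo (base cyc) xs) ys ≡ base cyc
    closes = trans (sym (lastTo-++ (base cyc) xs ys)) (closed cyc)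

  lastTo-∈ : ∀ p S → lastTo p S ∈ p ∷ map to S
  lastTo-∈ p [] = here refl
  lastTo-∈ p (l ∷ S) = there (lastTo-∈ (to l) S)

  private
    Unique-prefix : ∀ {B : Set} (f : Leg → B) a mid b rest → Unique (map f (a ∷ mid ++ b ∷ rest)) → Unique (f a ∷ map f mid ++ [ f b ])
    Unique-prefix f a mid b rest u =
      proj₁ (Unique-++⁻ (f a ∷ map f mid ++ [ f b ])
        (subst Unique (cong (f a ∷_) (trans (map-++ f mid (b ∷ rest)) (sym (++-assoc (map f mid) [ f b ] (map f rest))))) u))

  adjacentLegs-apart : ∀ {a b rest} → LegCycle (a ∷ b ∷ rest) → Disjoint (sources (edges a)) (sources (edges b))
  adjacentLegs-apart {a} {b} cyc {w} (w∈a , w∈b) = end∉sources (edges a) (path a) (subst (_∈ sources (edges a)) w≡to w∈a)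
    where
    a≢b : piece a ≢ piece b
    a≢b = All.head (AllPairs.head (distinctPieces cyc))
    to∈b : to a ∈V Gs (piece b)
    to∈b = subst (_∈V Gs (piece b)) (proj₁ (proj₂ (linked cyc))) (from∈piece b)
    w≡to : w ≡ to a
    w≡to = oneSharedVertex a≢b (sources∈piece a w∈a) (sources∈piece b w∈b) (to∈piece a) to∈b

  -- Cut the legs a and b at their common vertex w and close up through the legs between them.
  shortcut : ∀ a mid b d rest {w} → LegCycle (a ∷ mid ++ b ∷ d ∷ rest) →
    w ∈ sources (edges a) → w ∈ sources (edges b) → w ∉ map to (a ∷ mid) →
    ∃ λ S → LegCycle S × length S < length (a ∷ mid ++ b ∷ d ∷ rest)
  shortcut a mid b d rest {w} cyc w∈a w∈b w∉ with RainbowPath-split (edges a) (path a) w∈a | RainbowPath-split (edges b) (path b) w∈b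
  ... | _ , Ra , _ , _ , pRa | Lb , _ , _ , pLb , _ = a′ ∷ mid ++ [ b′ ] , cyc′ , shorter
    where
    linkedMid : Linked (to a) mid × Linked (lastTo (to a) mid) (b ∷ d ∷ rest)
    linkedMid = Linked-++⁻ (to a) mid (proj₂ (linked cyc))
    from-b : from b ≡ lastTo (to a) mid
    from-b = proj₁ (proj₂ linkedMid)
    a′ b′ : Leg
    a′ = record { piece = piece a ; from = w ; to = to a ; edges = Ra ; path = pRa ; from≢to = λ { refl → w∉ (here refl) } }
    b′ = record { piece = piece b ; from = from b ; to = w ; edges = Lb ; path = pLb
                ; from≢to = λ from≡w → w∉ (subst (_∈ map to (a ∷ mid)) (trans (sym from-b) from≡w) (lastTo-∈ (to a) mid)) }
    cyc′ : LegCycle (a′ ∷ mid ++ [ b′ ])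
    cyc′ = record
      { long = s≤s (subst (1 ≤_) (sym (trans (length-++ mid) (+-comm (length mid) 1))) (s≤s z≤n))
      ; base = w
      ; linked = refl , Linked-++⁺ (to a) mid (proj₁ linkedMid) (from-b , tt)
      ; closed = lastTo-++ (to a) mid [ b′ ]
      ; distinctPieces = subst Unique (cong (piece a ∷_) (sym (map-++ piece mid [ b′ ])))
                           (Unique-prefix piece a mid b (d ∷ rest) (distinctPieces cyc))
      ; distinctStops = subst Unique (cong (to a ∷_) (sym (map-++ to mid [ b′ ])))
                           (Unique-∷ʳ (to a ∷ map to mid) (proj₁ (Unique-++⁻ (to a ∷ map to mid) (Unique-prefix to a mid b (d ∷ rest) (distinctStops cyc)))) w∉)
      }
    shorter : length (a′ ∷ mid ++ [ b′ ]) < length (a ∷ mid ++ b ∷ d ∷ rest)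
    shorter = subst₂ (λ p q → suc p < suc q) (sym (length-++ mid)) (sym (length-++ mid))
      (s≤s (subst (_≤ length mid + suc (suc (length rest))) (+-suc (length mid) 1) (+-monoʳ-≤ (length mid) (s≤s (s≤s z≤n)))))

  Shorter : List Leg → Set
  Shorter S = ∀ S′ → length S′ < length S → ¬ LegCycle S′

  sharedVertex⇒shorter : ∀ a mid b rest {w} → LegCycle (a ∷ mid ++ b ∷ rest) →
    w ∈ sources (edges a) → w ∈ sources (edges b) → Shorter (a ∷ mid ++ b ∷ rest) → ⊥
  sharedVertex⇒shorter a [] b rest cyc w∈a w∈b _ = adjacentLegs-apart cyc (w∈a , w∈b)
  sharedVertex⇒shorter a mid b [] cyc w∈a w∈b _ = adjacentLegs-apart (LegCycle-rotate (a ∷ mid) [ b ] cyc) (w∈b , w∈a)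
  sharedVertex⇒shorter a (c ∷ mid) b (d ∷ rest) {w} cyc w∈a w∈b shorter with any? (w ≟_) (map to (a ∷ c ∷ mid))
  ... | no w∉ with shortcut a (c ∷ mid) b d rest cyc w∈a w∈b w∉
  ...   | S , cyc′ , S<  = shorter S S< cyc′
  sharedVertex⇒shorter a (c ∷ mid) b (d ∷ rest) {w} cyc w∈a w∈b shorter | yes w∈
    with shortcut b (d ∷ rest) a c mid (LegCycle-rotate (a ∷ c ∷ mid) (b ∷ d ∷ rest) cyc) w∈b w∈a w∉
    where
    w∉ : w ∉ map to (b ∷ d ∷ rest)
    w∉ w∈′ = Unique-map-++⇒Disjoint to (a ∷ c ∷ mid) (distinctStops cyc) (w∈ , w∈′)
  ... | S , cyc′ , S< = shorter S (subst (length S <_) (length-++-comm (b ∷ d ∷ rest) (a ∷ c ∷ mid)) S<) cyc′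

  legEdges : List Leg → List CEdge
  legEdges S = concat (map edges S)

  map-legEdges : ∀ {B : Set} (f : CEdge → B) S → map f (legEdges S) ≡ concat (map (λ l → map f (edges l)) S)
  map-legEdges f [] = refl
  map-legEdges f (l ∷ S) = trans (map-++ f (edges l) (legEdges S)) (cong (map f (edges l) ++_) (map-legEdges f S))

  chain-legEdges : ∀ p S → Linked p S → Chain p (lastTo p S) (legEdges S)
  chain-legEdges p [] _ = refl
  chain-legEdges p (l ∷ S) (refl , linked) = chain-++ (edges l) (proj₁ (path l)) (chain-legEdges (to l) S linked)

  legEdges⊆F : ∀ S → All (_∈ᶜ F) (legEdges S)
  legEdges⊆F [] = []
  legEdges⊆F (l ∷ S) = AllP.++⁺ (All.map (λ {e} → Gs⊆F (piece l) e) (proj₁ (proj₂ (path l)))) (legEdges⊆F S)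

  legEdges≢[] : ∀ S → 2 ≤ length S → legEdges S ≢ []
  legEdges≢[] (l ∷ S) _ eq = Chain⇒≢[] (edges l) (proj₁ (path l)) (from≢to l) (++-conicalˡ (edges l) _ eq)

  LegsApart : Leg → Leg → Set
  LegsApart a b = Disjoint (sources (edges a)) (sources (edges b))

  legColors-disjoint : ∀ {a b} → piece a ≢ piece b → Disjoint (colors (edges a)) (colors (edges b))
  legColors-disjoint {a} {b} a≢b (α∈a , α∈b) =
    noSharedColor a≢b (colors⊆χ (edges a) (proj₁ (proj₂ (path a))) α∈a) (colors⊆χ (edges b) (proj₁ (proj₂ (path b))) α∈b)

  apartLegCycle-odd : ∀ {S} → LegCycle S → AllPairs LegsApart S → Odd (length (legEdges S))
  apartLegCycle-odd {S} cyc apart = RainbowCircuit-odd wfF noEven (legEdges S) circuit (legEdges≢[] S (long cyc))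
    where
    colorsApart : AllPairs (λ a b → Disjoint (colors (edges a)) (colors (edges b))) S
    colorsApart = AllPairs.map (λ {a} {b} → legColors-disjoint {a} {b}) (AllPairsP.map⁻ (distinctPieces cyc))
    circuit : RainbowCircuit F (base cyc) (legEdges S)
    circuit = subst (λ q → Chain (base cyc) q (legEdges S)) (closed cyc) (chain-legEdges (base cyc) S (linked cyc)) ,
      legEdges⊆F S ,
      subst Unique (sym (map-legEdges src S))
        (Unique.concat⁺ (AllP.map⁺ (All.tabulate (λ {l} _ → Unique-sources (edges l) (path l)))) (AllPairsP.map⁺ apart)) ,
      subst Unique (sym (map-legEdges color S))
        (Unique.concat⁺ (AllP.map⁺ (All.tabulate (λ {l} _ → proj₂ (proj₂ (proj₂ (path l)))))) (AllPairsP.map⁺ colorsApart))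

  private
    isTree? : ∀ k → Dec (k ≡ treeK)
    isTree? cycleK = no λ ()
    isTree? badK = no λ ()
    isTree? treeK = yes refl

  -- Consecutive pieces share a vertex, so by (F1) they are not both trees.
  nonTreeFirst : ∀ {S} → LegCycle S → ∃ λ l → ∃ λ S′ → LegCycle (l ∷ S′) × length (l ∷ S′) ≡ length S × κ (piece l) ≢ treeK
  nonTreeFirst {[]} cyc with long cyc
  ... | ()
  nonTreeFirst {_ ∷ []} cyc with long cyc
  ... | s≤s ()
  nonTreeFirst {a ∷ b ∷ rest} cyc with isTree? (κ (piece a))
  ... | no a-nonTree = a , b ∷ rest , cyc , refl , a-nonTree
  ... | yes a-tree = b , rest ++ [ a ] , LegCycle-rotate [ a ] (b ∷ rest) cyc , length-++-comm (b ∷ rest) [ a ] , b-nonTree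
    where
    b-nonTree : κ (piece b) ≢ treeK
    b-nonTree b-tree = treesDisjoint (piece a) (piece b) (All.head (AllPairs.head (distinctPieces cyc))) a-tree b-tree (to a)
      (to∈piece a) (subst (_∈V Gs (piece b)) (proj₁ (proj₂ (linked cyc))) (from∈piece b))

  rerouteFirstLeg : ∀ l S → LegCycle (l ∷ S) → κ (piece l) ≢ treeK →
    ∃ λ l′ → LegCycle (l′ ∷ S) × Even (length (legEdges (l′ ∷ S)))
  rerouteFirstLeg l S cyc nonTree
    with nonTreePiece⇒BothParities wfF noEven (κ (piece l)) nonTree (fits (piece l)) (Gs⊆F (piece l)) (from∈piece l) (to∈piece l) (from≢to l)
           (length (legEdges S))
  ... | es , rp , even = l′ , cyc′ , subst Even (trans (+-comm (length (legEdges S)) (length es)) (sym (length-++ es))) even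
    where
    l′ : Leg
    l′ = record l { edges = es ; path = rp }
    cyc′ : LegCycle (l′ ∷ S)
    cyc′ = record { long = long cyc ; base = base cyc ; linked = linked cyc ; closed = closed cyc
                  ; distinctPieces = distinctPieces cyc ; distinctStops = distinctStops cyc }

  ¬AllPairs⇒pair : ∀ {A : Set} {R : A → A → Set} → (∀ a b → Dec (R a b)) → ∀ xs → ¬ AllPairs R xs →
    ∃ λ pre → ∃ λ a → ∃ λ mid → ∃ λ b → ∃ λ post → xs ≡ pre ++ a ∷ mid ++ b ∷ post × ¬ R a b
  ¬AllPairs⇒pair R? [] ¬all = ⊥-elim (¬all [])
  ¬AllPairs⇒pair {R = R} R? (x ∷ xs) ¬all with All.all? (R? x) xs
  ... | yes head with ¬AllPairs⇒pair R? xs (λ tail → ¬all (head ∷ tail))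
  ...   | pre , a , mid , b , post , refl , ¬r = x ∷ pre , a , mid , b , post , refl , ¬r
  ¬AllPairs⇒pair {R = R} R? (x ∷ xs) ¬all | no ¬head with firstFailure xs ¬head
    where
    firstFailure : ∀ ys → ¬ All (R x) ys → ∃ λ mid → ∃ λ b → ∃ λ post → ys ≡ mid ++ b ∷ post × ¬ R x b
    firstFailure [] ¬all′ = ⊥-elim (¬all′ [])
    firstFailure (y ∷ ys) ¬all′ with R? x y
    ... | no ¬r = [] , y , ys , refl , ¬r
    ... | yes r with firstFailure ys (λ rs → ¬all′ (r ∷ rs))
    ...   | mid , b , post , refl , ¬r = y ∷ mid , b , post , refl , ¬r
  ... | mid , b , post , refl , ¬r = [] , x , mid , b , post , refl , ¬r

  sharedOrApart : ∀ a b → (∃ λ w → w ∈ sources (edges a) × w ∈ sources (edges b)) ⊎ LegsApart a b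
  sharedOrApart a b with any? (λ v → any? (v ≟_) (sources (edges b))) (sources (edges a))
  ... | yes some = inj₁ (find some)
  ... | no none = inj₂ λ (w∈a , w∈b) → none (lose w∈a w∈b)

  LegsApart? : ∀ a b → Dec (LegsApart a b)
  LegsApart? a b with sharedOrApart a b
  ... | inj₁ (_ , w∈a , w∈b) = no λ apart → apart (w∈a , w∈b)
  ... | inj₂ apart = yes apart

  evenLegCycle-impossible : ∀ S → LegCycle S → Even (length (legEdges S)) → Shorter S → ⊥
  evenLegCycle-impossible S cyc even shorter with AllPairs.allPairs? LegsApart? S
  ... | yes apart = apartLegCycle-odd cyc apart even
  ... | no ¬apart with ¬AllPairs⇒pair LegsApart? S ¬apart
  ... | pre , a , mid , b , post , refl , ¬ab with sharedOrApart a b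
  ...   | inj₂ ab = ¬ab ab
  ...   | inj₁ (w , w∈a , w∈b) = sharedVertex⇒shorter a mid b (post ++ pre) rotated w∈a w∈b
            λ S′ S′< → shorter S′ (subst (length S′ <_) length-rotated S′<)
    where
    reassociate : (a ∷ mid ++ b ∷ post) ++ pre ≡ a ∷ mid ++ b ∷ post ++ pre
    reassociate = cong (a ∷_) (++-assoc mid (b ∷ post) pre)
    rotated : LegCycle (a ∷ mid ++ b ∷ post ++ pre)
    rotated = subst LegCycle reassociate (LegCycle-rotate pre (a ∷ mid ++ b ∷ post) cyc)
    length-rotated : length (a ∷ mid ++ b ∷ post ++ pre) ≡ length (pre ++ a ∷ mid ++ b ∷ post)
    length-rotated = trans (cong length (sym reassociate)) (length-++-comm (a ∷ mid ++ b ∷ post) pre)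

  noLegCycle : ∀ S → ¬ LegCycle S
  noLegCycle S = <-rec (λ n → ∀ S → length S ≡ n → ¬ LegCycle S) inductionStep (length S) S refl
    where
    inductionStep : ∀ n → (∀ {k} → k < n → ∀ S → length S ≡ k → ¬ LegCycle S) → ∀ S → length S ≡ n → ¬ LegCycle S
    inductionStep n rec S refl cyc with nonTreeFirst cyc
    ... | l , S′ , cyc′ , len≡ , nonTree with rerouteFirstLeg l S′ cyc′ nonTree
    ... | l′ , cyc″ , even = evenLegCycle-impossible (l′ ∷ S′) cyc″ even λ T T< → rec (subst (length T <_) len≡ T<) T refl

  Stop : Set
  Stop = Fin m × Vertex

  interleave : List Stop → List (Fin m ⊎ Vertex)
  interleave [] = []
  interleave ((i , v) ∷ L) = inj₁ i ∷ inj₂ v ∷ interleave L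

  private
    inj₁∈interleave : ∀ L {i} → i ∈ map proj₁ L → inj₁ i ∈ interleave L
    inj₁∈interleave (_ ∷ L) (here refl) = here refl
    inj₁∈interleave (_ ∷ L) (there i∈) = there (there (inj₁∈interleave L i∈))

    inj₂∈interleave : ∀ L {v} → v ∈ map proj₂ L → inj₂ v ∈ interleave L
    inj₂∈interleave (_ ∷ L) (here refl) = there (here refl)
    inj₂∈interleave (_ ∷ L) (there v∈) = there (there (inj₂∈interleave L v∈))

  Unique-interleave⁻ : ∀ L → Unique (interleave L) → Unique (map proj₁ L) × Unique (map proj₂ L)
  Unique-interleave⁻ [] _ = [] , []
  Unique-interleave⁻ ((i , v) ∷ L) (i∉ ∷ v∉ ∷ u) with Unique-interleave⁻ L u
  ... | u₁ , u₂ = Unique-∷⁺ (λ i∈ → All.lookup i∉ (there (inj₁∈interleave L i∈)) refl) u₁ ,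
                  Unique-∷⁺ (λ v∈ → All.lookup v∉ (inj₂∈interleave L v∈) refl) u₂

  nextPiece : Fin m → List Stop → Fin m
  nextPiece j [] = j
  nextPiece j ((i , _) ∷ _) = i

  Meets : List Stop → Fin m → Set
  Meets [] j = ⊤
  Meets ((i , v) ∷ L) j = v ∈V Gs i × v ∈V Gs (nextPiece j L) × Meets L j

  walk⇒stops : ∀ i ys j → Walk (BipAdj Gs) (inj₁ i ∷ ys ++ [ inj₁ j ]) →
    ∃ λ L → interleave L ≡ inj₁ i ∷ ys × Meets L j × nextPiece j L ≡ i
  walk⇒stops i [] j (() , _)
  walk⇒stops i (inj₁ _ ∷ ys) j (() , _)
  walk⇒stops i (inj₂ v ∷ []) j ((_ , v∈i) , (_ , v∈j) , _) = [ (i , v) ] , refl , (v∈i , v∈j , tt) , refl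
  walk⇒stops i (inj₂ v ∷ inj₂ _ ∷ ys) j (_ , () , _)
  walk⇒stops i (inj₂ v ∷ inj₁ k ∷ ys) j ((_ , v∈i) , (_ , v∈k) , walk) with walk⇒stops k ys j walk
  ... | L , eq , meets , refl = (i , v) ∷ L , cong (λ l → inj₁ i ∷ inj₂ v ∷ l) eq , (v∈i , v∈k , meets) , refl

  lastStop : Vertex → List Stop → Vertex
  lastStop p [] = p
  lastStop p ((_ , v) ∷ L) = lastStop v L

  StartsAt : Vertex → List Stop → Set
  StartsAt p [] = ⊤
  StartsAt p ((i , v) ∷ _) = p ∈V Gs i × p ≢ v

  stops⇒legs : ∀ p L j → StartsAt p L → Meets L j → Unique (map proj₂ L) →
    ∃ λ S → map piece S ≡ map proj₁ L × map to S ≡ map proj₂ L × Linked p S × lastTo p S ≡ lastStop p L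
  stops⇒legs p [] j _ _ _ = [] , refl , refl , tt , refl
  stops⇒legs p ((i , v) ∷ L) j (p∈ , p≢v) (v∈ , v∈next , meets) (v∉ ∷ u)
    with piece⇒RainbowPath wfF noEven (κ i) (fits i) (Gs⊆F i) p∈ v∈ p≢v | stops⇒legs v L j (startsAt L v∈next v∉) meets u
    where
    startsAt : ∀ L → v ∈V Gs (nextPiece j L) → All (v ≢_) (map proj₂ L) → StartsAt v L
    startsAt [] _ _ = tt
    startsAt (_ ∷ _) v∈′ (v≢ ∷ _) = v∈′ , v≢
  ... | es , rp | S , pieces , stops , linked , last =
    record { piece = i ; from = p ; to = v ; edges = es ; path = rp ; from≢to = p≢v } ∷ S ,
    cong (i ∷_) pieces , cong (v ∷_) stops , (refl , linked) , last

  private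
    lastStop-meets : ∀ d L j → Meets L j → L ≢ [] → lastStop d L ∈V Gs j
    lastStop-meets d [] j _ L≢[] = ⊥-elim (L≢[] refl)
    lastStop-meets d ((i , v) ∷ []) j (_ , v∈j , _) _ = v∈j
    lastStop-meets d ((i , v) ∷ e ∷ L) j (_ , _ , meets) _ = lastStop-meets v (e ∷ L) j meets (λ ())

    lastStop-∈ : ∀ d L → L ≢ [] → lastStop d L ∈ map proj₂ L
    lastStop-∈ d [] L≢[] = ⊥-elim (L≢[] refl)
    lastStop-∈ d ((i , v) ∷ []) _ = here refl
    lastStop-∈ d ((i , v) ∷ e ∷ L) _ = there (lastStop-∈ v (e ∷ L) (λ ()))

  walk⇒LegCycle : ∀ i ys → Walk (BipAdj Gs) (inj₁ i ∷ ys ++ [ inj₁ i ]) → Unique (inj₁ i ∷ ys) → 3 ≤ length (inj₁ i ∷ ys) →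
    ∃ LegCycle
  walk⇒LegCycle i ys walk u len≥3 with walk⇒stops i ys i walk
  ... | [] , () , _
  ... | (_ , _) ∷ [] , refl , _ with len≥3
  ...   | s≤s (s≤s ())
  walk⇒LegCycle i ys walk u len≥3 | (_ , v) ∷ e ∷ L , eq , meets , refl
    with Unique-interleave⁻ ((i , v) ∷ e ∷ L) (subst Unique (sym eq) u)
  ... | uniquePieces , uniqueStops@(v∉ ∷ _)
    with stops⇒legs (lastStop v (e ∷ L)) ((i , v) ∷ e ∷ L) i (lastStop-meets v (e ∷ L) i (proj₂ (proj₂ meets)) (λ ()) , start≢v) meets uniqueStops
    where
    start≢v : lastStop v (e ∷ L) ≢ v
    start≢v start≡v = All.lookup v∉ (lastStop-∈ v (e ∷ L) (λ ())) (sym start≡v)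
  ... | S , pieces , stops , linked , last = S , record
    { long = subst (2 ≤_) (trans (cong length (sym pieces)) (length-map piece S)) (s≤s (s≤s z≤n))
    ; base = lastStop v (e ∷ L)
    ; linked = linked
    ; closed = last
    ; distinctPieces = subst Unique (sym pieces) uniquePieces
    ; distinctStops = subst Unique (sym stops) uniqueStops
    }

  HasCycle⇒LegCycle : HasCycle (BipVertex Gs) (BipAdj Gs) → ∃ LegCycle
  HasCycle⇒LegCycle (inj₁ i , rest , len≥3 , u , _ , walk) = walk⇒LegCycle i rest walk u len≥3
  HasCycle⇒LegCycle (inj₂ _ , [] , s≤s () , _)
  HasCycle⇒LegCycle (inj₂ _ , inj₂ _ ∷ _ , _ , _ , _ , () , _)
  HasCycle⇒LegCycle (inj₂ v , inj₁ i ∷ rest , len≥3 , u , _ , adj , walk) =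
    walk⇒LegCycle i (rest ++ [ inj₂ v ]) (Walk-∷ʳ (inj₁ i) rest walk adj) (Unique-++-comm [ inj₂ v ] u)
      (subst (3 ≤_) (length-++-comm [ inj₂ v ] (inj₁ i ∷ rest)) len≥3)
    where
    Walk-∷ʳ : ∀ {A : Set} {R : A → A → Set} x xs {y z} → Walk R (x ∷ xs ++ [ y ]) → R y z → Walk R (x ∷ (xs ++ [ y ]) ++ [ z ])
    Walk-∷ʳ x [] (r , _) r′ = r , r′ , tt
    Walk-∷ʳ x (x′ ∷ xs) (r , walk) r′ = r , Walk-∷ʳ x′ xs walk r′

lemma2p6 : (F : ColGraph) (m : ℕ) (Gs : Fin m → ColGraph) (κ : Fin m → Kind)
    → IsFrankenstein F m Gs κ
    → Acyclic (BipVertex Gs) (BipAdj Gs)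
lemma2p6 F m Gs κ frankenstein cycle with Frankenstein.HasCycle⇒LegCycle frankenstein cycle
... | S , legCycle = Frankenstein.noLegCycle frankenstein S legCycle
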